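{- Let $p\geq 5$ be prime and $C_{I,p}:=6\left(\frac{\log(p+1)}{\log p}-1\right)^{ -1}$. Let $M\cdot x=a$ be a linear system over $\mathbb{F}_p$ with $m$ equations ($M$ an $m\times n$ matrix) such that $d_M\geq C_{I,p}\cdot m^3$, and let $f=b$ be a linear equation ($f$ a linear form in $x_1,\dots,x_n$, $b\in\mathbb{F}_p$). If every $x\in\{0,1\}^n$ satisfying $M\cdot x=a$ also satisfies $f=b$, then $f=b$ is in the span of $M\cdot x=a$.
   Context: For $v\in\mathbb{F}_p^n$, $\omega(v)$ is the number of nonzero coordinates of $v$; $d_M:=\min_{y\in\mathbb{F}_p^m,\,y\neq 0}\omega(y\cdot M)$. An equation $g=c$ is identified with the affine polynomial $g-c$; "in the span of $M\cdot x=a$" means $f-b$ is an $\mathbb{F}_p$-linear combination of the polynomials $(M\cdot x)_i-a_i$, $i=1,\dots,m$. -}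

module Defs where

open import Data.Nat using (ℕ; zero; suc; _+_; _*_; _^_; _≤_; NonZero)
open import Data.Nat.DivMod using (_%_)
open import Data.Fin using (Fin; toℕ)
import Data.Fin as F
open import Data.Bool using (Bool; true; false)
open import Data.Product using (Σ; _×_)
open import Relation.Binary.PropositionalEquality using (_≡_; _≢_)
open import Relation.Nullary using (¬_; yes; no)
open import Data.Nat using (_≟_)

-- Elements of 𝔽_p are represented by Fin p (residues 0,…,p-1);
-- arithmetic is done in ℕ and compared modulo p.

sumFin : (k : ℕ) → (Fin k → ℕ) → ℕ
sumFin zero    g = 0
sumFin (suc k) g = g F.zero + sumFin k (λ i → g (F.suc i))

_≡[mod_]_ : ℕ → (p : ℕ) → .{{NonZero p}} → ℕ → Set
(x ≡[mod p ] y) = x % p ≡ y % p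

countNZ : (p : ℕ) .{{_ : NonZero p}} (k : ℕ) → (Fin k → ℕ) → ℕ
countNZ p k g = sumFin k (λ j → indicator (g j % p))
  where
  indicator : ℕ → ℕ
  indicator n with n ≟ 0
  ... | yes _ = 0
  ... | no  _ = 1

Mat : ℕ → ℕ → ℕ → Set
Mat p m n = Fin m → Fin n → Fin p

rowComb : ∀ {p m n} → (Fin m → Fin p) → Mat p m n → Fin n → ℕ
rowComb {m = m} y M j = sumFin m (λ i → toℕ (y i) * toℕ (M i j))

weightRowComb : (p : ℕ) .{{_ : NonZero p}} {m n : ℕ} →
                (Fin m → Fin p) → Mat p m n → ℕ
weightRowComb p {m} {n} y M = countNZ p n (rowComb y M)

NonZeroVec : ∀ {p m} → (Fin m → Fin p) → Set
NonZeroVec {m = m} y = Σ (Fin m) (λ i → toℕ (y i) ≢ 0)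

-- d ≥ C_{I,p} · m³ where C_{I,p} = 6 (log(p+1)/log p − 1)⁻¹, rewritten
-- exactly (for p ≥ 2) as the integer inequality p^(d + 6 m³) ≤ (p+1)^d.
AboveCIp : (p m d : ℕ) → Set
AboveCIp p m d = p ^ (d + 6 * m ^ 3) ≤ (suc p) ^ d

-- d_M ≥ C_{I,p} · m³, i.e. every nonzero y has ω(y·M) ≥ C_{I,p} · m³
-- (the minimum is ≥ a bound iff every element is).
DistanceCondition : (p : ℕ) .{{_ : NonZero p}} {m n : ℕ} → Mat p m n → Set
DistanceCondition p {m} M =
  ∀ (y : Fin _ → Fin p) → NonZeroVec y → AboveCIp p m (weightRowComb p y M)

bit : Bool → ℕ
bit true  = 1
bit false = 0

SatSystem : (p : ℕ) .{{_ : NonZero p}} {m n : ℕ} →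
            Mat p m n → (Fin m → Fin p) → (Fin n → Bool) → Set
SatSystem p {m} {n} M a x =
  ∀ (i : Fin m) → sumFin n (λ j → toℕ (M i j) * bit (x j)) ≡[mod p ] toℕ (a i)

SatEq : (p : ℕ) .{{_ : NonZero p}} {n : ℕ} →
        (Fin n → Fin p) → Fin p → (Fin n → Bool) → Set
SatEq p {n} f b x = sumFin n (λ j → toℕ (f j) * bit (x j)) ≡[mod p ] toℕ b

InSpan : (p : ℕ) .{{_ : NonZero p}} {m n : ℕ} →
         Mat p m n → (Fin m → Fin p) → (Fin n → Fin p) → Fin p → Set
InSpan p {m} {n} M a f b =
  Σ (Fin m → Fin p) λ lam →
    (∀ (j : Fin n) → toℕ (f j) ≡[mod p ] sumFin m (λ i → toℕ (lam i) * toℕ (M i j)))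
    × (toℕ b ≡[mod p ] sumFin m (λ i → toℕ (lam i) * toℕ (a i)))

{-# OPTIONS --safe #-}
module Submission where

-- Every nonzero y is nonzero on more than 2(m(p − 2)T + m) columns of M, where 2^T ≤ p^m < 2^(T+1);
-- this is all that is used of the distance bound. A dissociated set of columns (pairwise distinct
-- 0/1-sums modulo p) has at most T elements, and every column outside a maximal one is the difference
-- of two of its subset sums. After removing m(p − 2) disjoint maximal dissociated sets the remaining
-- columns still span 𝔽_p^m; giving p − 2 of the sets to each column of a basis among them yields a
-- set Q of at most m(p − 2)T + m columns whose 0/1-sums cover all of 𝔽_p^m. The bound leaves room
-- for two disjoint such sets Q₀, Q₁ and a basis B outside both. Completing a 0/1-vector x supported
-- outside Q₀ by one supported on Q₀ to a solution of M x = a shows that f·x depends only on M x,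
-- and Q₁ together with B makes this dependence linear: f·x = λ·M x, hence f = λ M off Q₀ and
-- b = λ·a. Exchanging Q₀ and Q₁ gives f = λ M on Q₀ as well.

open import Defs
open import Data.Nat
open import Data.Nat.Properties
open import Data.Nat.DivMod using (_%_; m%n<n; m%n%n≡m%n; m*n%n≡0; m<n⇒m%n≡m; %-distribˡ-+; %-distribˡ-*)
open import Data.Nat.Divisibility using (n∣m⇒m%n≡0)
open import Data.Nat.Primality using (Prime; prime⇒irreducible; prime⇒nonTrivial)
open import Data.Nat.Coprimality using (Coprime; coprime-Bézout)
open import Data.Nat.GCD using (module Bézout)
open import Data.Nat.Tactic.RingSolver using (solve-∀)
open import Data.Bool using (Bool; true; false; not; _∨_)
open import Data.Empty using (⊥-elim)
open import Data.Fin as F using (Fin; toℕ; fromℕ<; combine; finToFun; funToFin)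
import Data.Fin.Properties as FinP
open import Data.Fin.Subset using (Subset; inside; outside; ⊤; ⊥; ⁅_⁆; _∈_; _∉_; _⊆_; _∪_; _─_; ⋃; ∣_∣)
open import Data.Fin.Subset.Properties
  using (_∈?_; ∈⊤; ∉⊥; ∣⊥∣≡0; x∈⁅x⁆; x∈⁅y⁆⇒x≡y; ∣⁅x⁆∣≡1; p⊆p∪q; q⊆p∪q; x∈p∪q⁺; x∈p∪q⁻;
         x∈p∧x∉q⇒x∈p─q; p─q⊆p; p─q─r≡p─q∪r; p─⊥≡p)
import Data.List as List
open import Data.List.Membership.Propositional using () renaming (_∈_ to _∈ₗ_)
open import Data.List.Membership.Propositional.Properties using (∈-allFin)
open import Data.List.Relation.Unary.Any using (here; there)
open import Data.Product using (Σ; ∃; ∃₂; _×_; _,_; proj₁; proj₂)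
open import Data.Sum as Sum using (_⊎_; inj₁; inj₂; [_,_]′)
open import Data.Vec using ([]; _∷_; lookup; tabulate; here; there)
open import Data.Vec.Properties using ([]=⇒lookup; lookup∘tabulate)
open import Data.Vec.Functional using () renaming (_∷_ to _∷ᶠ_)
open import Function using (_∘_)
open import Function.Definitions using (Injective)
open import Level using (0ℓ)
open import Relation.Binary using (Rel; Setoid)
import Relation.Binary.Reasoning.Setoid
open import Relation.Binary.PropositionalEquality
open import Relation.Nullary using (¬_; Dec; yes; no; does; map′; contradiction)
open import Relation.Nullary.Decidable using (dec-true)

sumFin-cong : ∀ k {g h : Fin k → ℕ} → (∀ i → g i ≡ h i) → sumFin k g ≡ sumFin k h
sumFin-cong zero    e = refl
sumFin-cong (suc k) e = cong₂ _+_ (e F.zero) (sumFin-cong k (e ∘ F.suc))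

sumFin-zero : ∀ k → sumFin k (λ _ → 0) ≡ 0
sumFin-zero zero    = refl
sumFin-zero (suc k) = sumFin-zero k

sumFin-const : ∀ k c → sumFin k (λ _ → c) ≡ k * c
sumFin-const zero    c = refl
sumFin-const (suc k) c = cong (c +_) (sumFin-const k c)

sumFin-mono-≤ : ∀ k {g h : Fin k → ℕ} → (∀ i → g i ≤ h i) → sumFin k g ≤ sumFin k h
sumFin-mono-≤ zero    le = z≤n
sumFin-mono-≤ (suc k) le = +-mono-≤ (le F.zero) (sumFin-mono-≤ k (le ∘ F.suc))

sumFin-distrib-+ : ∀ k (g h : Fin k → ℕ) →
                   sumFin k (λ i → g i + h i) ≡ sumFin k g + sumFin k h
sumFin-distrib-+ zero    g h = refl
sumFin-distrib-+ (suc k) g h = begin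
  g F.zero + h F.zero + sumFin k (λ i → g (F.suc i) + h (F.suc i))
    ≡⟨ cong (g F.zero + h F.zero +_) (sumFin-distrib-+ k (g ∘ F.suc) (h ∘ F.suc)) ⟩
  g F.zero + h F.zero + (sumFin k (g ∘ F.suc) + sumFin k (h ∘ F.suc))
    ≡⟨ +-+-comm (g F.zero) _ _ _ ⟩
  g F.zero + sumFin k (g ∘ F.suc) + (h F.zero + sumFin k (h ∘ F.suc)) ∎
  where
  open ≡-Reasoning
  +-+-comm : ∀ a b c d → a + b + (c + d) ≡ a + c + (b + d)
  +-+-comm = solve-∀

sumFin-*ˡ : ∀ k c (g : Fin k → ℕ) → sumFin k (λ i → c * g i) ≡ c * sumFin k g
sumFin-*ˡ zero    c g = sym (*-zeroʳ c)
sumFin-*ˡ (suc k) c g =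
  trans (cong (c * g F.zero +_) (sumFin-*ˡ k c (g ∘ F.suc))) (sym (*-distribˡ-+ c _ _))

sumFin-swap : ∀ k l (g : Fin k → Fin l → ℕ) →
              sumFin k (λ i → sumFin l (g i)) ≡ sumFin l (λ j → sumFin k (λ i → g i j))
sumFin-swap zero    l g = sym (sumFin-zero l)
sumFin-swap (suc k) l g =
  trans (cong (sumFin l (g F.zero) +_) (sumFin-swap k l (g ∘ F.suc)))
        (sym (sumFin-distrib-+ l (g F.zero) _))

sumFin-*ʳ : ∀ k c (g : Fin k → ℕ) → sumFin k (λ i → g i * c) ≡ sumFin k g * c
sumFin-*ʳ k c g = trans (sumFin-cong k (λ i → *-comm (g i) c)) (trans (sumFin-*ˡ k c g) (*-comm c _))

sumFin-compose : ∀ k m (u : Fin m → ℕ) (τ : Fin m → Fin k → ℕ) (g : Fin k → ℕ) →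
                 sumFin k (λ ℓ → sumFin m (λ i → u i * τ i ℓ) * g ℓ) ≡
                 sumFin m (λ i → u i * sumFin k (λ ℓ → τ i ℓ * g ℓ))
sumFin-compose k m u τ g = begin
  sumFin k (λ ℓ → sumFin m (λ i → u i * τ i ℓ) * g ℓ)
    ≡⟨ sumFin-cong k (λ ℓ → sumFin-*ʳ m (g ℓ) _) ⟨
  sumFin k (λ ℓ → sumFin m (λ i → u i * τ i ℓ * g ℓ))
    ≡⟨ sumFin-swap k m _ ⟩
  sumFin m (λ i → sumFin k (λ ℓ → u i * τ i ℓ * g ℓ))
    ≡⟨ sumFin-cong m (λ i → trans (sumFin-cong k (λ ℓ → *-assoc (u i) _ _)) (sumFin-*ˡ k (u i) _)) ⟩
  sumFin m (λ i → u i * sumFin k (λ ℓ → τ i ℓ * g ℓ))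
    ∎
  where open ≡-Reasoning

δ : ∀ {k} → Fin k → Fin k → ℕ
δ i r = bit (does (i F.≟ r))

sumFin-δ : ∀ k (g : Fin k → ℕ) r → sumFin k (λ i → δ i r * g i) ≡ g r
sumFin-δ (suc k) g F.zero    =
  trans (cong₂ _+_ (+-identityʳ (g F.zero)) (sumFin-zero k)) (+-identityʳ _)
sumFin-δ (suc k) g (F.suc r) = sumFin-δ k (g ∘ F.suc) r

module Modular (p : ℕ) .{{_ : NonZero p}} where

  infix 4 _≈_ _≋_

  _≈_ : Rel ℕ 0ℓ
  x ≈ y = x % p ≡ y % p

  ≈-setoid : Setoid 0ℓ 0ℓ
  ≈-setoid = record
    { _≈_ = _≈_ ; isEquivalence = record { refl = refl ; sym = sym ; trans = trans } }

  open Setoid ≈-setoid public using () renaming (refl to ≈-refl; sym to ≈-sym; trans to ≈-trans)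

  module ≈-Reasoning = Relation.Binary.Reasoning.Setoid ≈-setoid

  ≈-reflexive : ∀ {x y} → x ≡ y → x ≈ y
  ≈-reflexive = cong (_% p)

  _≈?_ : ∀ x y → Dec (x ≈ y)
  x ≈? y = x % p ≟ y % p

  %-≈ : ∀ x → x % p ≈ x
  %-≈ x = m%n%n≡m%n x p

  0%p≡0 : 0 % p ≡ 0
  0%p≡0 = m*n%n≡0 0 p

  *p≈0 : ∀ k → k * p ≈ 0
  *p≈0 k = trans (m*n%n≡0 k p) (sym 0%p≡0)

  ≈⇒≡ : ∀ {x y} → x < p → y < p → x ≈ y → x ≡ y
  ≈⇒≡ x<p y<p e = trans (sym (m<n⇒m%n≡m x<p)) (trans e (m<n⇒m%n≡m y<p))

  +-cong : ∀ {x x′ y y′} → x ≈ x′ → y ≈ y′ → x + y ≈ x′ + y′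
  +-cong {x} {x′} {y} {y′} e f = begin
    (x + y) % p               ≡⟨ %-distribˡ-+ x y p ⟩
    (x % p + y % p) % p       ≡⟨ cong₂ (λ a b → (a + b) % p) e f ⟩
    (x′ % p + y′ % p) % p     ≡⟨ %-distribˡ-+ x′ y′ p ⟨
    (x′ + y′) % p             ∎
    where open ≡-Reasoning

  *-cong : ∀ {x x′ y y′} → x ≈ x′ → y ≈ y′ → x * y ≈ x′ * y′
  *-cong {x} {x′} {y} {y′} e f = begin
    (x * y) % p               ≡⟨ %-distribˡ-* x y p ⟩
    (x % p * (y % p)) % p     ≡⟨ cong₂ (λ a b → (a * b) % p) e f ⟩
    (x′ % p * (y′ % p)) % p   ≡⟨ %-distribˡ-* x′ y′ p ⟨
    (x′ * y′) % p             ∎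
    where open ≡-Reasoning

  +-congˡ : ∀ x {y y′} → y ≈ y′ → x + y ≈ x + y′
  +-congˡ x = +-cong {x} refl

  +-congʳ : ∀ {x x′} y → x ≈ x′ → x + y ≈ x′ + y
  +-congʳ y e = +-cong e (refl {x = y % p})

  *-congˡ : ∀ x {y y′} → y ≈ y′ → x * y ≈ x * y′
  *-congˡ x = *-cong {x} refl

  *-congʳ : ∀ {x x′} y → x ≈ x′ → x * y ≈ x′ * y
  *-congʳ y e = *-cong e (refl {x = y % p})

  -- Additive inverse modulo p, chosen as a multiple of x (not p ∸ x % p) so that it commutes with sums.
  neg : ℕ → ℕ
  neg x = (p ∸ 1) * x

  +-inverseʳ : ∀ x → x + neg x ≈ 0
  +-inverseʳ x = trans (≈-reflexive x+neg-x≡x*p) (*p≈0 x)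
    where
    x+neg-x≡x*p : x + neg x ≡ x * p
    x+neg-x≡x*p = begin
      x + (p ∸ 1) * x  ≡⟨ cong (_+ (p ∸ 1) * x) (*-identityˡ x) ⟨
      1 * x + (p ∸ 1) * x ≡⟨ *-distribʳ-+ x 1 (p ∸ 1) ⟨
      suc (p ∸ 1) * x  ≡⟨ cong (_* x) (suc-pred p) ⟩
      p * x            ≡⟨ *-comm p x ⟩
      x * p            ∎
      where open ≡-Reasoning

  +-inverseˡ : ∀ x → neg x + x ≈ 0
  +-inverseˡ x = trans (≈-reflexive (+-comm (neg x) x)) (+-inverseʳ x)

  neg-+ : ∀ x y → neg (x + y) ≡ neg x + neg y
  neg-+ x y = *-distribˡ-+ (p ∸ 1) x y

  neg-* : ∀ x y → neg (x * y) ≡ x * neg y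
  neg-* x y = exchange (p ∸ 1) x y
    where
    exchange : ∀ a b c → a * (b * c) ≡ b * (a * c)
    exchange = solve-∀

  +-cancelˡ : ∀ x {y z} → x + y ≈ x + z → y ≈ z
  +-cancelˡ x {y} {z} e = begin
    y                  ≈⟨ +-congʳ y (+-inverseˡ x) ⟨
    neg x + x + y      ≡⟨ +-assoc (neg x) x y ⟩
    neg x + (x + y)    ≈⟨ +-congˡ (neg x) e ⟩
    neg x + (x + z)    ≡⟨ +-assoc (neg x) x z ⟨
    neg x + x + z      ≈⟨ +-congʳ z (+-inverseˡ x) ⟩
    z                  ∎
    where open ≈-Reasoning

  x+y≈z⇒y≈z-x : ∀ x y z → x + y ≈ z → y ≈ z + neg x
  x+y≈z⇒y≈z-x x y z e = +-cancelˡ x (begin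
    x + y              ≈⟨ e ⟩
    z                  ≡⟨ +-identityʳ z ⟨
    z + 0              ≈⟨ +-congˡ z (+-inverseʳ x) ⟨
    z + (x + neg x)    ≡⟨ exchange z x (neg x) ⟩
    x + (z + neg x)    ∎)
    where
    open ≈-Reasoning
    exchange : ∀ a b c → a + (b + c) ≡ b + (a + c)
    exchange = solve-∀

  x-y≈0⇒x≈y : ∀ x y → x + neg y ≈ 0 → x ≈ y
  x-y≈0⇒x≈y x y e = +-cancelˡ (neg y) (begin
    neg y + x    ≡⟨ +-comm (neg y) x ⟩
    x + neg y    ≈⟨ e ⟩
    0            ≈⟨ +-inverseˡ y ⟨
    neg y + y    ∎)
    where open ≈-Reasoning

  V : ℕ → Set
  V k = Fin k → ℕ

  _≋_ : ∀ {k} → Rel (V k) 0ℓ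
  u ≋ v = ∀ i → u i ≈ v i

  _≋?_ : ∀ {k} (u v : V k) → Dec (u ≋ v)
  u ≋? v = FinP.all? (λ i → u i ≈? v i)

  sumFin-cong-≈ : ∀ k {g h : Fin k → ℕ} → (∀ i → g i ≈ h i) → sumFin k g ≈ sumFin k h
  sumFin-cong-≈ zero    e = refl
  sumFin-cong-≈ (suc k) e = +-cong (e F.zero) (sumFin-cong-≈ k (e ∘ F.suc))

  reduce : ℕ → Fin p
  reduce x = fromℕ< (m%n<n x p)

  toℕ-reduce : ∀ x → toℕ (reduce x) ≡ x % p
  toℕ-reduce x = FinP.toℕ-fromℕ< _

  reduce-≈ : ∀ x → toℕ (reduce x) ≈ x
  reduce-≈ x = trans (≈-reflexive (toℕ-reduce x)) (%-≈ x)

  reduce-injective : ∀ {x y} → reduce x ≡ reduce y → x ≈ y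
  reduce-injective {x} {y} e = trans (sym (toℕ-reduce x)) (trans (cong toℕ e) (toℕ-reduce y))

  module _ (prime : Prime p) where

    ≉0⇒coprime : ∀ x → ¬ x ≈ 0 → Coprime x p
    ≉0⇒coprime x x≉0 {d} (d∣x , d∣p) with prime⇒irreducible prime d∣p
    ... | inj₁ d≡1 = d≡1
    ... | inj₂ refl = ⊥-elim (x≉0 (trans (n∣m⇒m%n≡0 x p d∣x) (sym 0%p≡0)))

    inverse : ∀ x → ¬ x ≈ 0 → ∃ λ y → x * y ≈ 1
    inverse x x≉0 with coprime-Bézout (≉0⇒coprime x x≉0)
    ... | Bézout.+- a b eq = a , (begin
      x * a          ≡⟨ trans (*-comm x a) (sym eq) ⟩
      1 + b * p      ≈⟨ +-congˡ 1 (*p≈0 b) ⟩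
      1 + 0          ∎)
      where open ≈-Reasoning
    ... | Bézout.-+ a b eq = neg a , +-cancelˡ (neg 1) (begin
      neg 1 + x * neg a      ≡⟨ cong (neg 1 +_) (neg-* x a) ⟨
      neg 1 + neg (x * a)    ≡⟨ cong (λ z → neg 1 + neg z) (*-comm x a) ⟩
      neg 1 + neg (a * x)    ≡⟨ neg-+ 1 (a * x) ⟨
      neg (1 + a * x)        ≈⟨ *-congˡ (p ∸ 1) (trans (≈-reflexive eq) (*p≈0 b)) ⟩
      neg 0                  ≡⟨ *-zeroʳ (p ∸ 1) ⟩
      0                      ≈⟨ +-inverseˡ 1 ⟨
      neg 1 + 1              ∎)
      where open ≈-Reasoning

funToFin-cong : ∀ {k q} {f g : Fin k → Fin q} → f ≗ g → funToFin f ≡ funToFin g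
funToFin-cong {zero}  f≗g = refl
funToFin-cong {suc k} f≗g = cong₂ combine (f≗g F.zero) (funToFin-cong (f≗g ∘ F.suc))

finToFun-injective : ∀ {k q} {c c′ : Fin (q ^ k)} → finToFun {q} {k} c ≗ finToFun c′ → c ≡ c′
finToFun-injective {k} {q} {c} {c′} e =
  trans (sym (FinP.funToFin-finToFin {k} {q} c)) (trans (funToFin-cong e) (FinP.funToFin-finToFin {k} {q} c′))

any-fun? : ∀ {k q} {P : (Fin k → Fin q) → Set} → (∀ {f g} → f ≗ g → P f → P g) →
           (∀ f → Dec (P f)) → Dec (∃ P)
any-fun? {k} {q} resp P? = map′ (λ (c , Pc) → finToFun c , Pc)
                        (λ (f , Pf) → funToFin f , resp (sym ∘ FinP.finToFun-funToFin f) Pf)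
                        (FinP.any? (P? ∘ finToFun {q} {k}))

module _ {k q l r : ℕ} (Φ : (Fin k → Fin q) → (Fin l → Fin r)) where

  private
    Φ♯ : Fin (q ^ k) → Fin (r ^ l)
    Φ♯ = funToFin ∘ Φ ∘ finToFun

    Φ♯-≡ : ∀ {c c′} → Φ♯ c ≡ Φ♯ c′ → Φ (finToFun c) ≗ Φ (finToFun c′)
    Φ♯-≡ {c} {c′} e j = begin
      Φ (finToFun c) j     ≡⟨ FinP.finToFun-funToFin (Φ (finToFun c)) j ⟨
      finToFun (Φ♯ c) j    ≡⟨ cong (λ z → finToFun z j) e ⟩
      finToFun (Φ♯ c′) j   ≡⟨ FinP.finToFun-funToFin (Φ (finToFun c′)) j ⟩
      Φ (finToFun c′) j    ∎
      where open ≡-Reasoning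

  injective⇒^≤^ : (∀ f g → Φ f ≗ Φ g → f ≗ g) → q ^ k ≤ r ^ l
  injective⇒^≤^ inj = FinP.injective⇒≤ {f = Φ♯} (finToFun-injective {k} {q} ∘ inj _ _ ∘ Φ♯-≡)

  pigeonhole-fun : r ^ l < q ^ k → ∃₂ λ f g → ¬ f ≗ g × Φ f ≗ Φ g
  pigeonhole-fun r^l<q^k with FinP.pigeonhole r^l<q^k Φ♯
  ... | c , c′ , c<c′ , e = finToFun c , finToFun c′ , FinP.<⇒≢ c<c′ ∘ finToFun-injective {k} {q} , Φ♯-≡ e

module LinearAlgebra (p : ℕ) .{{_ : NonZero p}} (prime : Prime p) (m : ℕ) where

  open Modular p

  1<p : 1 < p
  1<p = nonTrivial⇒n>1 p {{prime⇒nonTrivial prime}}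

  0ᵥ : ∀ {k} → V k
  0ᵥ _ = 0

  dot : V m → V m → ℕ
  dot y v = sumFin m (λ i → y i * v i)

  lin : ∀ {k} → (Fin k → V m) → V k → V m
  lin {k} fam t i = sumFin k (λ ℓ → t ℓ * fam ℓ i)

  Span : ∀ {k} → (Fin k → V m) → V m → Set
  Span fam u = ∃ λ t → lin fam t ≋ u

  Independent : ∀ {k} → (Fin k → V m) → Set
  Independent fam = ∀ t → lin fam t ≋ 0ᵥ → ∀ ℓ → t ℓ ≈ 0

  Separating : ∀ {n} → (Fin n → V m) → Subset n → Set
  Separating cand P = ∀ (y : Fin m → Fin p) → NonZeroVec y →
                      ∃ λ j → j ∈ P × ¬ dot (toℕ ∘ y) (cand j) ≈ 0

  lin-cong : ∀ {k} (fam : Fin k → V m) {t t′} → t ≋ t′ → lin fam t ≋ lin fam t′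
  lin-cong {k} fam e i = sumFin-cong-≈ k (λ ℓ → *-congʳ (fam ℓ i) (e ℓ))

  lin-+ : ∀ {k} (fam : Fin k → V m) t t′ i →
          lin fam (λ ℓ → t ℓ + t′ ℓ) i ≡ lin fam t i + lin fam t′ i
  lin-+ {k} fam t t′ i =
    trans (sumFin-cong k (λ ℓ → *-distribʳ-+ (fam ℓ i) (t ℓ) (t′ ℓ))) (sumFin-distrib-+ k _ _)

  lin-* : ∀ {k} (fam : Fin k → V m) c t i → lin fam (λ ℓ → c * t ℓ) i ≡ c * lin fam t i
  lin-* {k} fam c t i = trans (sumFin-cong k (λ ℓ → *-assoc c (t ℓ) (fam ℓ i))) (sumFin-*ˡ k c _)

  dot-cong : ∀ y {u v} → u ≋ v → dot y u ≈ dot y v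
  dot-cong y e = sumFin-cong-≈ m (λ i → *-congˡ (y i) (e i))

  dot-lin : ∀ {k} y (fam : Fin k → V m) t →
            dot y (lin fam t) ≡ sumFin k (λ ℓ → t ℓ * dot y (fam ℓ))
  dot-lin {k} y fam t = begin
    sumFin m (λ i → y i * sumFin k (λ ℓ → t ℓ * fam ℓ i))
      ≡⟨ sumFin-cong m (λ i → sumFin-*ˡ k (y i) _) ⟨
    sumFin m (λ i → sumFin k (λ ℓ → y i * (t ℓ * fam ℓ i)))
      ≡⟨ sumFin-swap m k _ ⟩
    sumFin k (λ ℓ → sumFin m (λ i → y i * (t ℓ * fam ℓ i)))
      ≡⟨ sumFin-cong k (λ ℓ → trans (sumFin-cong m (λ i → exchange (y i) (t ℓ) (fam ℓ i)))
                                     (sumFin-*ˡ m (t ℓ) _)) ⟩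
    sumFin k (λ ℓ → t ℓ * dot y (fam ℓ)) ∎
    where
    open ≡-Reasoning
    exchange : ∀ a b c → a * (b * c) ≡ b * (a * c)
    exchange = solve-∀

  dot-lin-≈0 : ∀ {k} y (fam : Fin k → V m) t → (∀ ℓ → dot y (fam ℓ) ≈ 0) → dot y (lin fam t) ≈ 0
  dot-lin-≈0 {k} y fam t ⊥fam = begin
    dot y (lin fam t)                     ≡⟨ dot-lin y fam t ⟩
    sumFin k (λ ℓ → t ℓ * dot y (fam ℓ))  ≈⟨ sumFin-cong-≈ k (λ ℓ → *-congˡ (t ℓ) (⊥fam ℓ)) ⟩
    sumFin k (λ ℓ → t ℓ * 0)              ≡⟨ sumFin-cong k (λ ℓ → *-zeroʳ (t ℓ)) ⟩
    sumFin k (λ _ → 0)                    ≡⟨ sumFin-zero k ⟩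
    0                                     ∎
    where open ≈-Reasoning

  lin-− : ∀ {k} (fam : Fin k → V m) t t′ → lin fam t ≋ lin fam t′ →
          lin fam (λ ℓ → t ℓ + neg (t′ ℓ)) ≋ 0ᵥ
  lin-− fam t t′ e i = begin
    lin fam (λ ℓ → t ℓ + neg (t′ ℓ)) i       ≡⟨ lin-+ fam t _ i ⟩
    lin fam t i + lin fam (neg ∘ t′) i       ≡⟨ cong (lin fam t i +_) (lin-* fam (p ∸ 1) t′ i) ⟩
    lin fam t i + neg (lin fam t′ i)         ≈⟨ +-congʳ _ (e i) ⟩
    lin fam t′ i + neg (lin fam t′ i)        ≈⟨ +-inverseʳ (lin fam t′ i) ⟩
    0                                        ∎
    where open ≈-Reasoning

  span? : ∀ {k} (fam : Fin k → V m) u → Dec (Span fam u)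
  span? fam u = map′ (λ (c , e) → toℕ ∘ c , e)
                     (λ (t , e) → reduce ∘ t , λ i → ≈-trans (lin-cong fam (reduce-≈ ∘ t) i) (e i))
                     (any-fun? (λ c≗c′ e i → ≈-trans (≈-reflexive (sumFin-cong _ (λ ℓ →
                                 cong (λ z → toℕ z * fam ℓ i) (sym (c≗c′ ℓ))))) (e i))
                               (λ c → lin fam (toℕ ∘ c) ≋? u))

  span-∷ : ∀ {k} (fam : Fin k → V m) u {v} → Span fam v → Span (u ∷ᶠ fam) v
  span-∷ fam u (t , e) = (0 ∷ᶠ t) , e

  span-member : ∀ {k} (fam : Fin k → V m) ℓ → Span fam (fam ℓ)
  span-member {k} fam ℓ = (λ ℓ′ → δ ℓ′ ℓ) , λ i → ≈-reflexive (sumFin-δ k (λ ℓ′ → fam ℓ′ i) ℓ)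

  independent⇒≤ : ∀ {k} (fam : Fin k → V m) → Independent fam → k ≤ m
  independent⇒≤ {k} fam indep =
    ≮⇒≥ λ m<k → <⇒≱ (^-monoʳ-< p 1<p m<k) (injective⇒^≤^ (λ c → reduce ∘ lin fam (toℕ ∘ c)) injective)
    where
    injective : ∀ c c′ → (reduce ∘ lin fam (toℕ ∘ c)) ≗ (reduce ∘ lin fam (toℕ ∘ c′)) → c ≗ c′
    injective c c′ e ℓ = FinP.toℕ-injective (≈⇒≡ (FinP.toℕ<n (c ℓ)) (FinP.toℕ<n (c′ ℓ))
      (x-y≈0⇒x≈y _ _ (indep (λ ℓ → toℕ (c ℓ) + neg (toℕ (c′ ℓ)))
                                (lin-− fam (toℕ ∘ c) (toℕ ∘ c′) (reduce-injective ∘ e)) ℓ)))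

  annihilator : ∀ {k} (fam : Fin k → V m) → k < m →
                ∃ λ (y : Fin m → Fin p) → NonZeroVec y × (∀ ℓ → dot (toℕ ∘ y) (fam ℓ) ≈ 0)
  annihilator {k} fam k<m with pigeonhole-fun Φ (^-monoʳ-< p 1<p k<m)
    where
    Φ : (Fin m → Fin p) → (Fin k → Fin p)
    Φ y ℓ = reduce (dot (toℕ ∘ y) (fam ℓ))
  ... | y₁ , y₂ , y₁≉y₂ , e = reduce ∘ y , nonzero , orthogonal
    where
    y : V m
    y i = toℕ (y₁ i) + neg (toℕ (y₂ i))
    dot-y : ∀ v → dot y v ≡ dot (toℕ ∘ y₁) v + neg (dot (toℕ ∘ y₂) v)
    dot-y v = begin
      sumFin m (λ i → (toℕ (y₁ i) + neg (toℕ (y₂ i))) * v i)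
        ≡⟨ sumFin-cong m (λ i → distrib (p ∸ 1) (toℕ (y₁ i)) (toℕ (y₂ i)) (v i)) ⟩
      sumFin m (λ i → toℕ (y₁ i) * v i + (p ∸ 1) * (toℕ (y₂ i) * v i))
        ≡⟨ sumFin-distrib-+ m _ _ ⟩
      dot (toℕ ∘ y₁) v + sumFin m (λ i → (p ∸ 1) * (toℕ (y₂ i) * v i))
        ≡⟨ cong (dot (toℕ ∘ y₁) v +_) (sumFin-*ˡ m (p ∸ 1) _) ⟩
      dot (toℕ ∘ y₁) v + neg (dot (toℕ ∘ y₂) v) ∎
      where
      open ≡-Reasoning
      distrib : ∀ q a b c → (a + q * b) * c ≡ a * c + q * (b * c)
      distrib = solve-∀
    orthogonal : ∀ ℓ → dot (toℕ ∘ reduce ∘ y) (fam ℓ) ≈ 0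
    orthogonal ℓ = begin
      dot (toℕ ∘ reduce ∘ y) (fam ℓ)   ≈⟨ sumFin-cong-≈ m (λ i → *-congʳ (fam ℓ i) (reduce-≈ (y i))) ⟩
      dot y (fam ℓ)                    ≡⟨ dot-y (fam ℓ) ⟩
      dot (toℕ ∘ y₁) (fam ℓ) + neg (dot (toℕ ∘ y₂) (fam ℓ)) ≈⟨ +-congʳ _ (reduce-injective (e ℓ)) ⟩
      dot (toℕ ∘ y₂) (fam ℓ) + neg (dot (toℕ ∘ y₂) (fam ℓ)) ≈⟨ +-inverseʳ _ ⟩
      0                                ∎
      where open ≈-Reasoning
    nonzero : NonZeroVec (reduce ∘ y)
    nonzero with FinP.¬∀⟶∃¬ m _ (λ i → y₁ i FinP.≟ y₂ i) y₁≉y₂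
    ... | i , y₁i≢y₂i = i , λ y≡0 → y₁i≢y₂i (FinP.toℕ-injective
            (≈⇒≡ (FinP.toℕ<n (y₁ i)) (FinP.toℕ<n (y₂ i))
              (x-y≈0⇒x≈y _ _ (trans (sym (toℕ-reduce (y i))) (trans y≡0 (sym 0%p≡0))))))

  independent-∷ : ∀ {k} (fam : Fin k → V m) u → Independent fam → ¬ Span fam u →
                  Independent (u ∷ᶠ fam)
  independent-∷ {k} fam u indep u∉span t t·fam≈0 with t F.zero ≈? 0
  ... | yes t₀≈0 = λ { F.zero → t₀≈0 ; (F.suc ℓ) → indep (t ∘ F.suc) rest≈0 ℓ }
    where
    rest≈0 : lin fam (t ∘ F.suc) ≋ 0ᵥ
    rest≈0 i = +-cancelˡ 0 (≈-trans (+-congʳ _ (≈-sym (*-congʳ (u i) t₀≈0))) (t·fam≈0 i))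
  ... | no  t₀≉0 = contradiction (t′ , t′-spans) u∉span
    where
    s = proj₁ (inverse prime (t F.zero) t₀≉0)
    L = lin fam (t ∘ F.suc)
    t′ : V k
    t′ ℓ = neg (s * t (F.suc ℓ))
    t′-spans : lin fam t′ ≋ u
    t′-spans i = ≈-sym (begin
      u i                           ≈⟨ x+y≈z⇒y≈z-x (s * L i) (u i) 0
                                         (≈-trans (≈-reflexive (+-comm (s * L i) (u i))) u+sL≈0) ⟩
      neg (s * L i)                 ≡⟨ cong neg (lin-* fam s (t ∘ F.suc) i) ⟨
      neg (lin fam (λ ℓ → s * t (F.suc ℓ)) i) ≡⟨ lin-* fam (p ∸ 1) _ i ⟨
      lin fam t′ i                  ∎)
      where
      open ≈-Reasoning
      rearrange : ∀ a b c d → a * (b * c + d) ≡ (b * a) * c + a * d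
      rearrange = solve-∀
      u+sL≈0 : u i + s * L i ≈ 0
      u+sL≈0 = begin
        u i + s * L i                   ≡⟨ cong (_+ s * L i) (*-identityˡ (u i)) ⟨
        1 * u i + s * L i               ≈⟨ +-congʳ _ (*-congʳ (u i) (proj₂ (inverse prime (t F.zero) t₀≉0))) ⟨
        (t F.zero * s) * u i + s * L i  ≡⟨ rearrange s (t F.zero) (u i) (L i) ⟨
        s * (t F.zero * u i + L i)      ≈⟨ *-congˡ s (t·fam≈0 i) ⟩
        s * 0                           ≡⟨ *-zeroʳ s ⟩
        0                               ∎

  module _ {n} (cand : Fin n → V m) (P : Subset n) where

    record Basis : Set where
      field
        size        : ℕ
        index       : Fin size → Fin n
        injective   : Injective _≡_ _≡_ index
        index∈P     : ∀ ℓ → index ℓ ∈ P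
        independent : Independent (cand ∘ index)

    open Basis

    private
      ∅ : Basis
      ∅ = record { size = 0 ; index = λ () ; injective = λ { {()} } ; index∈P = λ ()
                 ; independent = λ _ _ () }

      extend : (β : Basis) (j : Fin n) → j ∈ P → ¬ Span (cand ∘ index β) (cand j) → Basis
      extend β j j∈P ¬span = record
        { size        = suc (size β)
        ; index       = j ∷ᶠ index β
        ; injective   = injective′
        ; index∈P     = λ { F.zero → j∈P ; (F.suc ℓ) → index∈P β ℓ }
        ; independent = independent-∷ (cand ∘ index β) (cand j) (independent β) ¬span
        }
        where
        j∉image : ∀ ℓ → j ≢ index β ℓ
        j∉image ℓ refl = ¬span (span-member (cand ∘ index β) ℓ)
        injective′ : Injective _≡_ _≡_ (j ∷ᶠ index β)
        injective′ {F.zero}  {F.zero}  _ = refl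
        injective′ {F.zero}  {F.suc ℓ} e = contradiction e (j∉image ℓ)
        injective′ {F.suc ℓ} {F.zero}  e = contradiction (sym e) (j∉image ℓ)
        injective′ {F.suc ℓ} {F.suc ℓ′} e = cong F.suc (injective β e)

      greedy : (L : List.List (Fin n)) → Σ Basis λ β →
               ∀ {j} → j ∈ₗ L → j ∈ P → Span (cand ∘ index β) (cand j)
      greedy List.[] = ∅ , λ ()
      greedy (j List.∷ L) with greedy L
      ... | β , spans with j ∈? P
      ...   | no j∉P = β , λ { (here refl) j∈P → contradiction j∈P j∉P ; (there j′∈L) → spans j′∈L }
      ...   | yes j∈P with span? (cand ∘ index β) (cand j)
      ...     | yes span = β , λ { (here refl) _ → span ; (there j′∈L) → spans j′∈L }
      ...     | no ¬span = extend β j j∈P ¬span ,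
                  λ { (here refl) _ → span-member (cand ∘ (j ∷ᶠ index β)) F.zero
                    ; (there j′∈L) j′∈P → span-∷ (cand ∘ index β) (cand j) (spans j′∈L j′∈P) }

    size≤m : (β : Basis) → size β ≤ m
    size≤m β = independent⇒≤ (cand ∘ index β) (independent β)

    separating⇒spans : (β : Basis) → Separating cand P →
                       (∀ {j} → j ∈ P → Span (cand ∘ index β) (cand j)) →
                       ∀ u → Span (cand ∘ index β) u
    separating⇒spans β separating spans-cand u with span? (cand ∘ index β) u
    ... | yes span = span
    ... | no ¬span =
      let y , y≢0 , y⊥fam = annihilator fam (independent⇒≤ (u ∷ᶠ fam) (independent-∷ fam u (independent β) ¬span))
          j , j∈P , y·j≉0 = separating y y≢0
          t , t·fam≈j     = spans-cand j∈P
      in contradiction (≈-trans (≈-sym (dot-cong (toℕ ∘ y) t·fam≈j)) (dot-lin-≈0 (toℕ ∘ y) fam t y⊥fam)) y·j≉0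
      where
      fam = cand ∘ index β

    spanning-basis : Separating cand P → Σ Basis λ β → ∀ u → Span (cand ∘ index β) u
    spanning-basis separating =
      proj₁ greedy-all , separating⇒spans (proj₁ greedy-all) separating (proj₂ greedy-all (∈-allFin _))
      where greedy-all = greedy (List.allFin n)

Disjoint : ∀ {n} → Subset n → Subset n → Set
Disjoint X Y = ∀ {j} → j ∈ X → j ∉ Y

PairwiseDisjoint : ∀ {n K} → (Fin K → Subset n) → Set
PairwiseDisjoint Q = ∀ {c c′} → c ≢ c′ → Disjoint (Q c) (Q c′)

x∈p─q⇒x∉q : ∀ {n} {x : Fin n} (p q : Subset n) → x ∈ p ─ q → x ∉ q
x∈p─q⇒x∉q (_ ∷ p) (inside  ∷ q) (there x∈p─q) (there x∈q) = x∈p─q⇒x∉q p q x∈p─q x∈q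
x∈p─q⇒x∉q (_ ∷ p) (outside ∷ q) (there x∈p─q) (there x∈q) = x∈p─q⇒x∉q p q x∈p─q x∈q

∣p∪q∣≤∣p∣+∣q∣ : ∀ {n} (p q : Subset n) → ∣ p ∪ q ∣ ≤ ∣ p ∣ + ∣ q ∣
∣p∪q∣≤∣p∣+∣q∣ []            []      = z≤n
∣p∪q∣≤∣p∣+∣q∣ (inside  ∷ p) (outside ∷ q) = s≤s (∣p∪q∣≤∣p∣+∣q∣ p q)
∣p∪q∣≤∣p∣+∣q∣ (inside  ∷ p) (inside  ∷ q) = s≤s (≤-trans (∣p∪q∣≤∣p∣+∣q∣ p q) (+-monoʳ-≤ ∣ p ∣ (n≤1+n ∣ q ∣)))
∣p∪q∣≤∣p∣+∣q∣ (outside ∷ p) (inside  ∷ q) = ≤-trans (s≤s (∣p∪q∣≤∣p∣+∣q∣ p q)) (≤-reflexive (sym (+-suc _ _)))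
∣p∪q∣≤∣p∣+∣q∣ (outside ∷ p) (outside ∷ q) = ∣p∪q∣≤∣p∣+∣q∣ p q

private
  there-∃ : ∀ {n s t} {P Q : Subset n} → (∃ λ x → x ∈ Q × x ∉ P) → ∃ λ x → x ∈ s ∷ Q × x ∉ t ∷ P
  there-∃ (x , x∈Q , x∉P) = F.suc x , there x∈Q , λ { (there x∈P) → x∉P x∈P }

∣p∣<∣q∣⇒∃∈q∉p : ∀ {n} (P Q : Subset n) → ∣ P ∣ < ∣ Q ∣ → ∃ λ x → x ∈ Q × x ∉ P
∣p∣<∣q∣⇒∃∈q∉p (outside ∷ P) (inside  ∷ Q) _        = F.zero , here , λ ()
∣p∣<∣q∣⇒∃∈q∉p (inside  ∷ P) (inside  ∷ Q) (s≤s lt) = there-∃ (∣p∣<∣q∣⇒∃∈q∉p P Q lt)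
∣p∣<∣q∣⇒∃∈q∉p (inside  ∷ P) (outside ∷ Q) lt       = there-∃ (∣p∣<∣q∣⇒∃∈q∉p P Q (<-trans (n<1+n _) lt))
∣p∣<∣q∣⇒∃∈q∉p (outside ∷ P) (outside ∷ Q) lt       = there-∃ (∣p∣<∣q∣⇒∃∈q∉p P Q lt)

⋃ᶠ : ∀ {n K} → (Fin K → Subset n) → Subset n
⋃ᶠ Q = ⋃ (List.tabulate Q)

∈⋃ᶠ⁺ : ∀ {n K} (Q : Fin K → Subset n) {j} c → j ∈ Q c → j ∈ ⋃ᶠ Q
∈⋃ᶠ⁺ Q F.zero    j∈Q = x∈p∪q⁺ (inj₁ j∈Q)
∈⋃ᶠ⁺ Q (F.suc c) j∈Q = x∈p∪q⁺ (inj₂ (∈⋃ᶠ⁺ (Q ∘ F.suc) c j∈Q))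

∈⋃ᶠ⁻ : ∀ {n K} (Q : Fin K → Subset n) {j} → j ∈ ⋃ᶠ Q → ∃ λ c → j ∈ Q c
∈⋃ᶠ⁻ {K = zero}  Q j∈⋃ = contradiction j∈⋃ ∉⊥
∈⋃ᶠ⁻ {K = suc K} Q j∈⋃ with x∈p∪q⁻ (Q F.zero) (⋃ᶠ (Q ∘ F.suc)) j∈⋃
... | inj₁ j∈Q₀ = F.zero , j∈Q₀
... | inj₂ j∈⋃′ = let c , j∈Q = ∈⋃ᶠ⁻ (Q ∘ F.suc) j∈⋃′ in F.suc c , j∈Q

∣⋃ᶠ∣≤ : ∀ {n K} (Q : Fin K → Subset n) → ∣ ⋃ᶠ Q ∣ ≤ sumFin K (∣_∣ ∘ Q)
∣⋃ᶠ∣≤ {n} {zero}  Q = ≤-reflexive (∣⊥∣≡0 n)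
∣⋃ᶠ∣≤ {n} {suc K} Q = ≤-trans (∣p∪q∣≤∣p∣+∣q∣ (Q F.zero) _) (+-monoʳ-≤ ∣ Q F.zero ∣ (∣⋃ᶠ∣≤ (Q ∘ F.suc)))

disjoint-⋃ᶠ : ∀ {n K} {X : Subset n} (Q : Fin K → Subset n) → (∀ c → Disjoint X (Q c)) → Disjoint X (⋃ᶠ Q)
disjoint-⋃ᶠ Q disj j∈X j∈⋃ = let c , j∈Q = ∈⋃ᶠ⁻ Q j∈⋃ in disj c j∈X j∈Q

image : ∀ {n t} → (Fin t → Fin n) → Subset n
image z = ⋃ᶠ (⁅_⁆ ∘ z)

∈image : ∀ {n t} (z : Fin t → Fin n) r → z r ∈ image z
∈image z r = ∈⋃ᶠ⁺ (⁅_⁆ ∘ z) r (x∈⁅x⁆ (z r))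

∈image⁻ : ∀ {n t} (z : Fin t → Fin n) {j} → j ∈ image z → ∃ λ r → j ≡ z r
∈image⁻ z j∈image = let r , j∈⁅zr⁆ = ∈⋃ᶠ⁻ (⁅_⁆ ∘ z) j∈image in r , x∈⁅y⁆⇒x≡y (z r) j∈⁅zr⁆

∣image∣≤ : ∀ {n t} (z : Fin t → Fin n) → ∣ image z ∣ ≤ t
∣image∣≤ {t = t} z = ≤-trans (∣⋃ᶠ∣≤ (⁅_⁆ ∘ z))
                             (≤-reflexive (trans (sumFin-cong t (∣⁅x⁆∣≡1 ∘ z))
                                                 (trans (sumFin-const t 1) (*-identityʳ t))))

⁅⁆-pairwiseDisjoint : ∀ {n t} (z : Fin t → Fin n) → Injective _≡_ _≡_ z → PairwiseDisjoint (⁅_⁆ ∘ z)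
⁅⁆-pairwiseDisjoint z inj r≢r′ j∈r j∈r′ =
  r≢r′ (inj (trans (sym (x∈⁅y⁆⇒x≡y _ j∈r)) (x∈⁅y⁆⇒x≡y _ j∈r′)))

-- Written with bit so that it agrees definitionally with the sums in SatSystem and SatEq.
sumOver : ∀ {n} → (Fin n → ℕ) → Subset n → ℕ
sumOver {n} g X = sumFin n (λ j → g j * bit (lookup X j))

sumOver-⊥ : ∀ {n} (g : Fin n → ℕ) → sumOver g ⊥ ≡ 0
sumOver-⊥ {zero}  g = refl
sumOver-⊥ {suc n} g = trans (cong (_+ sumOver (g ∘ F.suc) ⊥) (*-zeroʳ (g F.zero))) (sumOver-⊥ (g ∘ F.suc))

sumOver-⁅⁆ : ∀ {n} (g : Fin n → ℕ) j → sumOver g ⁅ j ⁆ ≡ g j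
sumOver-⁅⁆ {suc n} g F.zero    =
  trans (cong₂ _+_ (*-identityʳ (g F.zero)) (sumOver-⊥ (g ∘ F.suc))) (+-identityʳ (g F.zero))
sumOver-⁅⁆ {suc n} g (F.suc j) =
  trans (cong (_+ sumOver (g ∘ F.suc) ⁅ j ⁆) (*-zeroʳ (g F.zero))) (sumOver-⁅⁆ (g ∘ F.suc) j)

sumOver-∪ : ∀ {n} (g : Fin n → ℕ) (X Y : Subset n) → Disjoint X Y →
            sumOver g (X ∪ Y) ≡ sumOver g X + sumOver g Y
sumOver-∪ g []      []      _    = refl
sumOver-∪ g (x ∷ X) (y ∷ Y) disj = begin
  g F.zero * bit (x ∨ y) + sumOver (g ∘ F.suc) (X ∪ Y)
    ≡⟨ cong₂ _+_ (cong (g F.zero *_) (bit-∨ x y λ { (refl , refl) → disj here here }))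
                 (sumOver-∪ (g ∘ F.suc) X Y (λ j∈X j∈Y → disj (there j∈X) (there j∈Y))) ⟩
  g F.zero * (bit x + bit y) + (sumOver (g ∘ F.suc) X + sumOver (g ∘ F.suc) Y)
    ≡⟨ rearrange (g F.zero) (bit x) (bit y) _ _ ⟩
  (g F.zero * bit x + sumOver (g ∘ F.suc) X) + (g F.zero * bit y + sumOver (g ∘ F.suc) Y) ∎
  where
  open ≡-Reasoning
  bit-∨ : ∀ x y → ¬ (x ≡ true × y ≡ true) → bit (x ∨ y) ≡ bit x + bit y
  bit-∨ true  true  both = ⊥-elim (both (refl , refl))
  bit-∨ true  false _    = refl
  bit-∨ false y     _    = refl
  rearrange : ∀ a b c d e → a * (b + c) + (d + e) ≡ (a * b + d) + (a * c + e)
  rearrange = solve-∀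

module Support (p : ℕ) .{{_ : NonZero p}} where

  open Modular p

  support : ∀ {k} → (Fin k → ℕ) → Subset k
  support g = tabulate (λ j → not (does (g j % p ≟ 0)))

  ∣support∣≡countNZ : ∀ k (g : Fin k → ℕ) → ∣ support g ∣ ≡ countNZ p k g
  ∣support∣≡countNZ zero    g = refl
  ∣support∣≡countNZ (suc k) g with g F.zero % p
  ... | zero  = ∣support∣≡countNZ k (g ∘ F.suc)
  ... | suc _ = cong suc (∣support∣≡countNZ k (g ∘ F.suc))

  ∈support⇒≉0 : ∀ {k} (g : Fin k → ℕ) {j} → j ∈ support g → ¬ g j ≈ 0
  ∈support⇒≉0 g {j} j∈ g≈0 = contradiction (begin
    false                      ≡⟨ cong not (dec-true (g j % p ≟ 0) (trans g≈0 0%p≡0)) ⟨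
    not (does (g j % p ≟ 0))   ≡⟨ lookup∘tabulate _ j ⟨
    lookup (support g) j       ≡⟨ []=⇒lookup j∈ ⟩
    true                       ∎) λ ()
    where open ≡-Reasoning

module Realization (p : ℕ) .{{_ : NonZero p}} {m n : ℕ} (col : Fin n → Fin m → ℕ) where

  open Modular p

  colSum : Subset n → V m
  colSum X i = sumOver (λ j → col j i) X

  Realizes : Subset n → V m → Set
  Realizes Q v = ∃ λ X → X ⊆ Q × colSum X ≋ v

  realizes-≋ : ∀ {Q v w} → v ≋ w → Realizes Q v → Realizes Q w
  realizes-≋ v≋w (X , X⊆Q , sum≋v) = X , X⊆Q , λ i → ≈-trans (sum≋v i) (v≋w i)

  realizes-⊆ : ∀ {Q Q′ v} → Q ⊆ Q′ → Realizes Q v → Realizes Q′ v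
  realizes-⊆ Q⊆Q′ (X , X⊆Q , sum≋v) = X , Q⊆Q′ ∘ X⊆Q , sum≋v

  realizes-0 : ∀ {Q} → Realizes Q (λ _ → 0)
  realizes-0 = ⊥ , (λ j∈⊥ → contradiction j∈⊥ ∉⊥) , λ i → ≈-reflexive (sumOver-⊥ (λ j → col j i))

  realizes-col : ∀ {Q j} → j ∈ Q → Realizes Q (col j)
  realizes-col {j = j} j∈Q = ⁅ j ⁆ , (λ x∈⁅j⁆ → subst (_∈ _) (sym (x∈⁅y⁆⇒x≡y j x∈⁅j⁆)) j∈Q)
                           , λ i → ≈-reflexive (sumOver-⁅⁆ (λ j → col j i) j)

  realizes-∪ : ∀ {Q Q′ v w} → Disjoint Q Q′ → Realizes Q v → Realizes Q′ w →
               Realizes (Q ∪ Q′) (λ i → v i + w i)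
  realizes-∪ {Q} {Q′} disj (X , X⊆Q , X≋v) (Y , Y⊆Q′ , Y≋w) =
    X ∪ Y , ∪-mono , λ i → ≈-trans (≈-reflexive (sumOver-∪ (λ j → col j i) X Y (λ x y → disj (X⊆Q x) (Y⊆Q′ y))))
                                   (+-cong (X≋v i) (Y≋w i))
    where
    ∪-mono : X ∪ Y ⊆ Q ∪ Q′
    ∪-mono j∈X∪Y = x∈p∪q⁺ ([ inj₁ ∘ X⊆Q , inj₂ ∘ Y⊆Q′ ]′ (x∈p∪q⁻ X Y j∈X∪Y))

  realizes-⋃ᶠ : ∀ {K} (Q : Fin K → Subset n) (v : Fin K → V m) → PairwiseDisjoint Q →
                (∀ c → Realizes (Q c) (v c)) → Realizes (⋃ᶠ Q) (λ i → sumFin K (λ c → v c i))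
  realizes-⋃ᶠ {zero}  Q v disj real = realizes-0
  realizes-⋃ᶠ {suc K} Q v disj real =
    realizes-∪ (disjoint-⋃ᶠ (Q ∘ F.suc) (λ c → disj (λ ())))
               (real F.zero)
               (realizes-⋃ᶠ (Q ∘ F.suc) (v ∘ F.suc) (λ c≢c′ → disj (c≢c′ ∘ FinP.suc-injective)) (real ∘ F.suc))

  Absorbs : Subset n → Fin n → Set
  Absorbs R w = ∃ λ β → Realizes R β × Realizes R (λ i → β i + col w i)

  private
    ⋃ᶠ-realizes-multiples : ∀ {q} (R : Fin q → Subset n) w → PairwiseDisjoint R → (∀ c → Absorbs (R c) w) →
                            ∃ λ (base : V m) → ∀ s → s ≤ q → Realizes (⋃ᶠ R) (λ i → base i + s * col w i)
    ⋃ᶠ-realizes-multiples {zero}  R w _    _      = (λ _ → 0) , λ { zero z≤n → realizes-0 }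
    ⋃ᶠ-realizes-multiples {suc q} R w disj absorb = (λ i → β i + base i) , realize
      where
      β : V m
      β = proj₁ (absorb F.zero)
      rest : ∃ λ (base : V m) → ∀ s → s ≤ q → Realizes (⋃ᶠ (R ∘ F.suc)) (λ i → base i + s * col w i)
      rest = ⋃ᶠ-realizes-multiples (R ∘ F.suc) w (λ c≢c′ → disj (c≢c′ ∘ FinP.suc-injective)) (absorb ∘ F.suc)
      base : V m
      base = proj₁ rest
      R₀#rest : Disjoint (R F.zero) (⋃ᶠ (R ∘ F.suc))
      R₀#rest = disjoint-⋃ᶠ (R ∘ F.suc) (λ c → disj (λ ()))
      realize : ∀ s → s ≤ suc q → Realizes (⋃ᶠ R) (λ i → β i + base i + s * col w i)
      realize zero    _         = realizes-≋ (λ i → ≈-reflexive (sym (+-assoc (β i) (base i) 0)))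
                                    (realizes-∪ R₀#rest (proj₁ (proj₂ (absorb F.zero))) (proj₂ rest 0 z≤n))
      realize (suc s) (s≤s s≤q) = realizes-≋ (λ i → ≈-reflexive (rearrange (β i) (col w i) (base i) (s * col w i)))
                                    (realizes-∪ R₀#rest (proj₂ (proj₂ (absorb F.zero))) (proj₂ rest s s≤q))
        where
        rearrange : ∀ a b c d → (a + b) + (c + d) ≡ a + c + (b + d)
        rearrange = solve-∀

  realizes-multiples : ∀ {q} (R : Fin q → Subset n) w → PairwiseDisjoint R → (∀ c → w ∉ R c) →
                       (∀ c → Absorbs (R c) w) →
                       ∃ λ (base : V m) → ∀ s → s ≤ suc q → Realizes (⁅ w ⁆ ∪ ⋃ᶠ R) (λ i → base i + s * col w i)
  realizes-multiples {q} R w disj w∉R absorb = base , realize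
    where
    rest : ∃ λ (base : V m) → ∀ s → s ≤ q → Realizes (⋃ᶠ R) (λ i → base i + s * col w i)
    rest = ⋃ᶠ-realizes-multiples R w disj absorb
    base : V m
    base = proj₁ rest
    w#R : Disjoint ⁅ w ⁆ (⋃ᶠ R)
    w#R = disjoint-⋃ᶠ R (λ c j∈⁅w⁆ j∈R → w∉R c (subst (_∈ R c) (x∈⁅y⁆⇒x≡y w j∈⁅w⁆) j∈R))
    realize : ∀ s → s ≤ suc q → Realizes (⁅ w ⁆ ∪ ⋃ᶠ R) (λ i → base i + s * col w i)
    realize zero    _         = realizes-∪ w#R realizes-0 (proj₂ rest 0 z≤n)
    realize (suc s) (s≤s s≤q) = realizes-≋ (λ i → ≈-reflexive (rearrange (col w i) (base i) (s * col w i)))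
                                  (realizes-∪ w#R (realizes-col (x∈⁅x⁆ w)) (proj₂ rest s s≤q))
      where
      rearrange : ∀ a b c → a + (b + c) ≡ b + (a + c)
      rearrange = solve-∀

module Dissociation (p : ℕ) .{{_ : NonZero p}} {m n : ℕ} (col : Fin n → Fin m → ℕ) where

  open Modular p
  open Realization p col

  -- Selections are Fin 2-valued so that they can be enumerated with any-fun?.
  selSum : ∀ {t} → (Fin t → Fin n) → (Fin t → Fin 2) → V m
  selSum {t} z b i = sumFin t (λ r → toℕ (b r) * col (z r) i)

  Dissociated : ∀ {t} → (Fin t → Fin n) → Set
  Dissociated z = ∀ b b′ → selSum z b ≋ selSum z b′ → b ≗ b′

  Toggles : ∀ {t} → (Fin t → Fin n) → Fin n → Set
  Toggles z j = ∃₂ λ α β → (λ i → selSum z β i + col j i) ≋ selSum z α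

  selSum-cong : ∀ {t} (z : Fin t → Fin n) {b b′} → b ≗ b′ → selSum z b ≋ selSum z b′
  selSum-cong {t} z b≗b′ i = ≈-reflexive (sumFin-cong t (λ r → cong (λ c → toℕ c * col (z r) i) (b≗b′ r)))

  toggles? : ∀ {t} (z : Fin t → Fin n) j → Dec (Toggles z j)
  toggles? z j = any-fun? (λ α≗α′ (β , e) → β , λ i → ≈-trans (e i) (selSum-cong z α≗α′ i))
                   (λ α → any-fun? (λ β≗β′ e i → ≈-trans (+-congʳ (col j i) (≈-sym (selSum-cong z β≗β′ i))) (e i))
                                   (λ β → (λ i → selSum z β i + col j i) ≋? selSum z α))

  dissociated-∷ : ∀ {t} (z : Fin t → Fin n) j → Dissociated z → ¬ Toggles z j → Dissociated (j ∷ᶠ z)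
  dissociated-∷ {t} z j dis ¬tog b b′ e = λ { F.zero → proj₁ heads≡×tails≗ ; (F.suc r) → proj₂ heads≡×tails≗ r }
    where
    shuffle : ∀ a s → s + a ≡ a + 0 + s
    shuffle a s = trans (+-comm s a) (cong (_+ s) (sym (+-identityʳ a)))
    heads-tails : ∀ x y (β β′ : Fin t → Fin 2) →
                  (∀ i → toℕ x * col j i + selSum z β i ≈ toℕ y * col j i + selSum z β′ i) →
                  x ≡ y × β ≗ β′
    heads-tails F.zero           F.zero           β β′ e = refl , dis β β′ e
    heads-tails (F.suc F.zero)   (F.suc F.zero)   β β′ e = refl , dis β β′ (λ i → +-cancelˡ (col j i + 0) (e i))
    heads-tails F.zero           (F.suc F.zero)   β β′ e =
      contradiction (β , β′ , λ i → ≈-trans (≈-reflexive (shuffle (col j i) _)) (≈-sym (e i))) ¬tog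
    heads-tails (F.suc F.zero)   F.zero           β β′ e =
      contradiction (β′ , β , λ i → ≈-trans (≈-reflexive (shuffle (col j i) _)) (e i)) ¬tog
    heads≡×tails≗ = heads-tails (b F.zero) (b′ F.zero) (b ∘ F.suc) (b′ ∘ F.suc) e

  dissociated-size : ∀ {t} (z : Fin t → Fin n) → Dissociated z → 2 ^ t ≤ p ^ m
  dissociated-size z dis = injective⇒^≤^ (λ b → reduce ∘ selSum z b)
                             (λ b b′ e → dis b b′ (reduce-injective ∘ e))

  realizes-selSum : ∀ {t} (z : Fin t → Fin n) → Injective _≡_ _≡_ z → ∀ b → Realizes (image z) (selSum z b)
  realizes-selSum z inj b =
    realizes-⋃ᶠ (⁅_⁆ ∘ z) (λ r i → toℕ (b r) * col (z r) i) (⁅⁆-pairwiseDisjoint z inj) piece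
    where
    piece : ∀ r → Realizes ⁅ z r ⁆ (λ i → toℕ (b r) * col (z r) i)
    piece r with b r
    ... | F.zero       = realizes-0
    ... | F.suc F.zero = realizes-≋ (λ i → ≈-reflexive (sym (+-identityʳ (col (z r) i))))
                                    (realizes-col (x∈⁅x⁆ (z r)))

  record DissociatedIn (A : Subset n) : Set where
    field
      size        : ℕ
      elems       : Fin size → Fin n
      injective   : Injective _≡_ _≡_ elems
      dissociated : Dissociated elems
      elems∈A     : ∀ r → elems r ∈ A

  open DissociatedIn

  private
    ∅ : ∀ {A} → DissociatedIn A
    ∅ = record { size = 0 ; elems = λ () ; injective = λ { {()} } ; dissociated = λ _ _ _ () ; elems∈A = λ () }

    extend : ∀ {A} (D : DissociatedIn A) j → j ∈ A → j ∉ image (elems D) → ¬ Toggles (elems D) j →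
             DissociatedIn A
    extend D j j∈A j∉D ¬tog = record
      { size        = suc (size D)
      ; elems       = j ∷ᶠ elems D
      ; injective   = injective′
      ; dissociated = dissociated-∷ (elems D) j (dissociated D) ¬tog
      ; elems∈A     = λ { F.zero → j∈A ; (F.suc r) → elems∈A D r }
      }
      where
      j≢ : ∀ r → j ≢ elems D r
      j≢ r refl = j∉D (∈image (elems D) r)
      injective′ : Injective _≡_ _≡_ (j ∷ᶠ elems D)
      injective′ {F.zero}  {F.zero}   _ = refl
      injective′ {F.zero}  {F.suc r′} e = contradiction e (j≢ r′)
      injective′ {F.suc r} {F.zero}   e = contradiction (sym e) (j≢ r)
      injective′ {F.suc r} {F.suc r′} e = cong F.suc (injective D e)

    toggles-∷ : ∀ {t} (z : Fin t → Fin n) j {j′} → Toggles z j′ → Toggles (j ∷ᶠ z) j′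
    toggles-∷ z j (α , β , e) = F.zero ∷ᶠ α , F.zero ∷ᶠ β , e

    greedy : ∀ A (L : List.List (Fin n)) → Σ (DissociatedIn A) λ D →
             ∀ {j} → j ∈ₗ L → j ∈ A → j ∉ image (elems D) → Toggles (elems D) j
    greedy A List.[] = ∅ , λ ()
    greedy A (j List.∷ L) with greedy A L
    ... | D , tog with j ∈? A
    ...   | no j∉A = D , λ { (here refl) j∈A → contradiction j∈A j∉A ; (there j′∈L) → tog j′∈L }
    ...   | yes j∈A with j ∈? image (elems D)
    ...     | yes j∈D = D , λ { (here refl) _ j∉D → contradiction j∈D j∉D ; (there j′∈L) → tog j′∈L }
    ...     | no j∉D with toggles? (elems D) j
    ...       | yes t = D , λ { (here refl) _ _ → t ; (there j′∈L) → tog j′∈L }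
    ...       | no ¬t = extend D j j∈A j∉D ¬t ,
                  λ { (here refl) _ j∉D′ → contradiction (∈image (j ∷ᶠ elems D) F.zero) j∉D′
                    ; (there j′∈L) j′∈A j′∉D′ →
                        toggles-∷ (elems D) j (tog j′∈L j′∈A (j′∉D′ ∘ q⊆p∪q ⁅ j ⁆ (image (elems D)))) }

  maximal-dissociated : (A : Subset n) → ∃ λ R → R ⊆ A × 2 ^ ∣ R ∣ ≤ p ^ m × (∀ {j} → j ∈ A → j ∉ R → Absorbs R j)
  maximal-dissociated A = image z , R⊆A , small , absorbs
    where
    D = proj₁ (greedy A (List.allFin n))
    z = elems D
    R⊆A : image z ⊆ A
    R⊆A j∈R with ∈image⁻ z j∈R
    ... | r , refl = elems∈A D r
    small : 2 ^ ∣ image z ∣ ≤ p ^ m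
    small = ≤-trans (^-monoʳ-≤ 2 (∣image∣≤ z)) (dissociated-size z (dissociated D))
    absorbs : ∀ {j} → j ∈ A → j ∉ image z → Absorbs (image z) j
    absorbs j∈A j∉R with proj₂ (greedy A (List.allFin n)) (∈-allFin _) j∈A j∉R
    ... | α , β , e = selSum z β , realizes-selSum z (injective D) β
                    , realizes-≋ (≈-sym ∘ e) (realizes-selSum z (injective D) α)

module UniversalSets (p : ℕ) .{{_ : NonZero p}} (prime : Prime p) {m n : ℕ} (col : Fin n → Fin m → ℕ) where

  open Modular p
  open LinearAlgebra p prime m
  open Realization p col
  open Dissociation p col
  open Support p

  record Gadgets (A : Subset n) (N : ℕ) : Set where
    field
      region   : Fin N → Subset n
      disjoint : PairwiseDisjoint region
      region⊆A : ∀ c → region c ⊆ A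
      small    : ∀ c → 2 ^ ∣ region c ∣ ≤ p ^ m
      absorbs  : ∀ {j} → j ∈ A → j ∉ ⋃ᶠ region → ∀ c → Absorbs (region c) j

  gadgets : ∀ N A → Gadgets A N
  gadgets zero    A = record { region = λ () ; disjoint = λ { {()} } ; region⊆A = λ ()
                             ; small = λ () ; absorbs = λ _ _ () }
  gadgets (suc N) A with maximal-dissociated A
  ... | R , R⊆A , R-small , R-absorbs = record
    { region   = R ∷ᶠ region
    ; disjoint = disjoint′
    ; region⊆A = λ { F.zero → R⊆A ; (F.suc c) → p─q⊆p A R ∘ region⊆A c }
    ; small    = λ { F.zero → R-small ; (F.suc c) → small c }
    ; absorbs   = absorbs′
    }
    where
    open Gadgets (gadgets N (A ─ R))
    R#region : ∀ c → Disjoint R (region c)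
    R#region c j∈R j∈c = x∈p─q⇒x∉q A R (region⊆A c j∈c) j∈R
    disjoint′ : PairwiseDisjoint (R ∷ᶠ region)
    disjoint′ {F.zero}  {F.zero}   c≢c′ = contradiction refl c≢c′
    disjoint′ {F.zero}  {F.suc c′} _    = R#region c′
    disjoint′ {F.suc c} {F.zero}   _    = λ j∈c j∈R → R#region c j∈R j∈c
    disjoint′ {F.suc c} {F.suc c′} c≢c′ = disjoint (c≢c′ ∘ cong F.suc)
    absorbs′ : ∀ {j} → j ∈ A → j ∉ R ∪ ⋃ᶠ region → ∀ c → Absorbs ((R ∷ᶠ region) c) j
    absorbs′ j∈A j∉ F.zero    = R-absorbs j∈A (j∉ ∘ p⊆p∪q _)
    absorbs′ j∈A j∉ (F.suc c) = absorbs (x∈p∧x∉q⇒x∈p─q j∈A (j∉ ∘ p⊆p∪q _)) (j∉ ∘ q⊆p∪q R _) c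

  Universal : Subset n → Set
  Universal Q = ∀ v → Realizes Q v

  RobustlySeparating : ℕ → Subset n → Set
  RobustlySeparating k A = ∀ U → ∣ U ∣ ≤ k → Separating col (A ─ U)

  robust-≤ : ∀ {k k′ A} → k′ ≤ k → RobustlySeparating k A → RobustlySeparating k′ A
  robust-≤ k′≤k robust U ∣U∣≤k′ = robust U (≤-trans ∣U∣≤k′ k′≤k)

  robust-─ : ∀ {k A} Q → RobustlySeparating (∣ Q ∣ + k) A → RobustlySeparating k (A ─ Q)
  robust-─ {A = A} Q robust U ∣U∣≤k = subst (Separating col) (sym (p─q─r≡p─q∪r A Q U))
    (robust (Q ∪ U) (≤-trans (∣p∪q∣≤∣p∣+∣q∣ Q U) (+-monoʳ-≤ ∣ Q ∣ ∣U∣≤k)))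

  robust⇒separating : ∀ {A} → RobustlySeparating 0 A → Separating col A
  robust⇒separating {A} robust = subst (Separating col) (p─⊥≡p A) (robust ⊥ (≤-reflexive (∣⊥∣≡0 n)))

  heavy⇒robustly-separating : ∀ k → (∀ y → NonZeroVec y → k < countNZ p n (λ j → dot (toℕ ∘ y) (col j))) →
                          RobustlySeparating k ⊤
  heavy⇒robustly-separating k heavy U ∣U∣≤k y y≢0 =
    let j , j∈S , j∉U = ∣p∣<∣q∣⇒∃∈q∉p U (support g)
                          (≤-<-trans ∣U∣≤k (subst (k <_) (sym (∣support∣≡countNZ n g)) (heavy y y≢0)))
    in j , x∈p∧x∉q⇒x∈p─q ∈⊤ j∉U , ∈support⇒≉0 g j∈S
    where
    g : Fin n → ℕ
    g j = dot (toℕ ∘ y) (col j)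

  module _ {A : Subset n} (G : Gadgets A (m * (p ∸ 2))) where

    open Gadgets G

    module _ (β : Basis col (A ─ ⋃ᶠ region)) (spans : ∀ u → Span (col ∘ Basis.index β) u) where

      open Basis β renaming (size to k; index to B)

      private
        U = ⋃ᶠ region
        q = p ∸ 2

        B∈A : ∀ ℓ → B ℓ ∈ A
        B∈A ℓ = p─q⊆p A U (index∈P ℓ)

        B∉U : ∀ ℓ → B ℓ ∉ U
        B∉U ℓ = x∈p─q⇒x∉q A U (index∈P ℓ)

        -- Each basis column owns p − 2 of the gadgets; with the column itself they
        -- realize all of its multiples 0, 1, …, p − 1.
        slot : Fin k → Fin q → Fin (m * q)
        slot ℓ c = combine (F.inject≤ ℓ (size≤m col (A ─ U) β)) c

        slot-injective : ∀ {ℓ ℓ′ c c′} → slot ℓ c ≡ slot ℓ′ c′ → ℓ ≡ ℓ′ × c ≡ c′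
        slot-injective {ℓ} {ℓ′} {c} {c′} e =
          FinP.inject≤-injective _ _ ℓ ℓ′ (FinP.combine-injectiveˡ {m} {q} _ c _ c′ e) ,
          FinP.combine-injectiveʳ {m} {q} _ c _ c′ e

        block : Fin k → Subset n
        block ℓ = ⁅ B ℓ ⁆ ∪ ⋃ᶠ (region ∘ slot ℓ)

        InBlock : Fin k → Fin n → Set
        InBlock ℓ j = j ≡ B ℓ ⊎ ∃ λ c → j ∈ region (slot ℓ c)

        block⁻ : ∀ {ℓ j} → j ∈ block ℓ → InBlock ℓ j
        block⁻ {ℓ} j∈ = Sum.map (x∈⁅y⁆⇒x≡y (B ℓ)) (∈⋃ᶠ⁻ (region ∘ slot ℓ)) (x∈p∪q⁻ ⁅ B ℓ ⁆ _ j∈)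

        B∉region : ∀ ℓ {j ℓ′ c′} → j ≡ B ℓ → j ∉ region (slot ℓ′ c′)
        B∉region ℓ refl = B∉U ℓ ∘ ∈⋃ᶠ⁺ region _

        InBlock-unique : ∀ {ℓ ℓ′ j} → InBlock ℓ j → InBlock ℓ′ j → ℓ ≡ ℓ′
        InBlock-unique (inj₁ j≡Bℓ)      (inj₁ j≡Bℓ′)      = injective (trans (sym j≡Bℓ) j≡Bℓ′)
        InBlock-unique {ℓ} (inj₁ j≡Bℓ)  (inj₂ (_ , j∈c′)) = contradiction j∈c′ (B∉region ℓ j≡Bℓ)
        InBlock-unique {ℓ′ = ℓ′} (inj₂ (_ , j∈c)) (inj₁ j≡Bℓ′) = contradiction j∈c (B∉region ℓ′ j≡Bℓ′)
        InBlock-unique (inj₂ (c , j∈c)) (inj₂ (c′ , j∈c′)) with slot _ c FinP.≟ slot _ c′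
        ... | yes e = proj₁ (slot-injective e)
        ... | no  c≢c′ = contradiction j∈c′ (disjoint c≢c′ j∈c)

        blocks-disjoint : PairwiseDisjoint block
        blocks-disjoint ℓ≢ℓ′ j∈ j∈′ = ℓ≢ℓ′ (InBlock-unique (block⁻ j∈) (block⁻ j∈′))

        blocks⊆ : ⋃ᶠ block ⊆ U ∪ image B
        blocks⊆ j∈ = let ℓ , j∈ℓ = ∈⋃ᶠ⁻ block j∈ in
          x∈p∪q⁺ (Sum.swap (Sum.map (λ j≡Bℓ → subst (_∈ image B) (sym j≡Bℓ) (∈image B ℓ))
                                    (λ (c , j∈c) → ∈⋃ᶠ⁺ region _ j∈c) (block⁻ j∈ℓ)))

        multiples : ∀ ℓ → ∃ λ (base : V m) → ∀ s → s ≤ suc q → Realizes (block ℓ) (λ i → base i + s * col (B ℓ) i)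
        multiples ℓ = realizes-multiples (region ∘ slot ℓ) (B ℓ)
                        (λ c≢c′ → disjoint (c≢c′ ∘ proj₂ ∘ slot-injective))
                        (λ c B∈ → B∉U ℓ (∈⋃ᶠ⁺ region _ B∈))
                        (absorbs (B∈A ℓ) (B∉U ℓ) ∘ slot ℓ)

        base : V m
        base i = sumFin k (λ ℓ → proj₁ (multiples ℓ) i)

        %p≤suc-q : ∀ x → x % p ≤ suc q
        %p≤suc-q x = ≤-pred (≤-trans (m%n<n x p) (≤-reflexive (trans (sym (m∸n+n≡m 2≤p)) (+-comm q 2))))
          where
          2≤p : 2 ≤ p
          2≤p = nonTrivial⇒n>1 p {{prime⇒nonTrivial prime}}

      gadgets∪basis-universal : Universal (U ∪ image B)
      gadgets∪basis-universal u = realizes-⊆ blocks⊆ (realizes-≋ sum≈u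
                      (realizes-⋃ᶠ block (λ ℓ i → proj₁ (multiples ℓ) i + s ℓ * col (B ℓ) i) blocks-disjoint
                                   (λ ℓ → proj₂ (multiples ℓ) (s ℓ) (%p≤suc-q (t ℓ)))))
        where
        t = proj₁ (spans (λ i → u i + neg (base i)))
        s : V k
        s ℓ = t ℓ % p
        sum≈u : (λ i → sumFin k (λ ℓ → proj₁ (multiples ℓ) i + s ℓ * col (B ℓ) i)) ≋ u
        sum≈u i = begin
          sumFin k (λ ℓ → proj₁ (multiples ℓ) i + s ℓ * col (B ℓ) i) ≡⟨ sumFin-distrib-+ k _ _ ⟩
          base i + lin (col ∘ B) s i                ≈⟨ +-congˡ (base i) (lin-cong (col ∘ B) (%-≈ ∘ t) i) ⟩
          base i + lin (col ∘ B) t i                ≈⟨ +-congˡ (base i) (proj₂ (spans _) i) ⟩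
          base i + (u i + neg (base i))             ≡⟨ solve-swap (base i) (u i) _ ⟩
          u i + (base i + neg (base i))             ≈⟨ +-congˡ (u i) (+-inverseʳ (base i)) ⟩
          u i + 0                                   ≡⟨ +-identityʳ (u i) ⟩
          u i                                       ∎
          where
          open ≈-Reasoning
          solve-swap : ∀ a b c → a + (b + c) ≡ b + (a + c)
          solve-swap a b c = trans (sym (+-assoc a b c)) (trans (cong (_+ c) (+-comm a b)) (+-assoc b a c))

  universal-subset : ∀ T → (∀ {t} → 2 ^ t ≤ p ^ m → t ≤ T) →
                     ∀ A → RobustlySeparating (m * (p ∸ 2) * T) A →
                     ∃ λ Q → Q ⊆ A × ∣ Q ∣ ≤ m * (p ∸ 2) * T + m × Universal Q
  universal-subset T T-bound A robust = U ∪ image B , Q⊆A , ∣Q∣≤ , gadgets∪basis-universal G β spans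
    where
    G = gadgets (m * (p ∸ 2)) A
    open Gadgets G
    U = ⋃ᶠ region
    ∣U∣≤ : ∣ U ∣ ≤ m * (p ∸ 2) * T
    ∣U∣≤ = ≤-trans (∣⋃ᶠ∣≤ region) (≤-trans (sumFin-mono-≤ _ (T-bound ∘ small))
                                           (≤-reflexive (sumFin-const (m * (p ∸ 2)) T)))
    basis = spanning-basis col (A ─ U) (robust U ∣U∣≤)
    β = proj₁ basis
    spans = proj₂ basis
    B = Basis.index β
    Q⊆A : U ∪ image B ⊆ A
    Q⊆A j∈Q with x∈p∪q⁻ U (image B) j∈Q
    ... | inj₁ j∈U = let c , j∈c = ∈⋃ᶠ⁻ region j∈U in region⊆A c j∈c
    ... | inj₂ j∈B with ∈image⁻ B j∈B
    ...   | ℓ , refl = p─q⊆p A U (Basis.index∈P β ℓ)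
    ∣Q∣≤ : ∣ U ∪ image B ∣ ≤ m * (p ∸ 2) * T + m
    ∣Q∣≤ = ≤-trans (∣p∪q∣≤∣p∣+∣q∣ U (image B))
                   (+-mono-≤ ∣U∣≤ (≤-trans (∣image∣≤ B) (size≤m col (A ─ U) β)))

  universal-pair : ∀ T → (∀ {t} → 2 ^ t ≤ p ^ m → t ≤ T) →
                   RobustlySeparating (2 * (m * (p ∸ 2) * T + m)) ⊤ →
                   ∃ λ Q → ∃ λ Q′ → Universal Q × Universal Q′ × Disjoint Q Q′ × Separating col (⊤ ─ Q ─ Q′)
  universal-pair T T-bound robust =
    Q , Q′ , universal-Q , universal-Q′ , (λ j∈Q j∈Q′ → x∈p─q⇒x∉q ⊤ Q (Q′⊆ j∈Q′) j∈Q) ,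
    robust⇒separating (robust-─ Q′ (robust-≤ (≤-trans (≤-reflexive (+-identityʳ ∣ Q′ ∣)) ∣Q′∣≤k) robust-⊤─Q))
    where
    k = m * (p ∸ 2) * T + m
    first = universal-subset T T-bound ⊤ (robust-≤ (≤-trans (m≤m+n _ m) (m≤m+n k (k + 0))) robust)
    Q = proj₁ first
    ∣Q∣≤k = proj₁ (proj₂ (proj₂ first))
    universal-Q = proj₂ (proj₂ (proj₂ first))
    robust-⊤─Q : RobustlySeparating k (⊤ ─ Q)
    robust-⊤─Q = robust-─ Q (robust-≤ (≤-trans (+-monoˡ-≤ k ∣Q∣≤k) (≤-reflexive (cong (k +_) (sym (+-identityʳ k)))))
                                      robust)
    second = universal-subset T T-bound (⊤ ─ Q) (robust-≤ (m≤m+n _ m) robust-⊤─Q)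
    Q′ = proj₁ second
    Q′⊆ = proj₁ (proj₂ second)
    ∣Q′∣≤k = proj₁ (proj₂ (proj₂ second))
    universal-Q′ = proj₂ (proj₂ (proj₂ second))

module ImpliedEquation (p : ℕ) .{{_ : NonZero p}} (prime : Prime p) {m n : ℕ} (col : Fin n → Fin m → ℕ)
                       (a : Fin m → ℕ) (f : Fin n → ℕ) (b : ℕ) where

  open Modular p
  open LinearAlgebra p prime m
  open Realization p col
  open UniversalSets p prime col

  module _ {k} (B : Fin k → Fin n) (coords : ∀ u → Span (col ∘ B) u) where

    unit : Fin m → V m
    unit i r = δ i r

    -- Defined through the basis alone, so that both instances of Completion below,
    -- with the roles of Q and Q′ exchanged, produce the same coefficients.
    multiplier : V m
    multiplier i = sumFin k (λ ℓ → proj₁ (coords (unit i)) ℓ * f (B ℓ))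

    module Completion (implied : ∀ X → colSum X ≋ a → sumOver f X ≈ b)
                      {Q Q′ : Subset n} (U : Universal Q) (U′ : Universal Q′) (Q′#Q : Disjoint Q′ Q)
                      (B∉Q : ∀ ℓ → B ℓ ∉ Q) (B∉Q′ : ∀ ℓ → B ℓ ∉ Q′) where

      -- The value of f on any subset outside Q with column sum v: a subset of Q with
      -- column sum a − v completes it to a solution of M x = a.
      ψ : V m → ℕ
      ψ v = b + neg (sumOver f (proj₁ (U (λ i → a i + neg (v i)))))

      ψ-realized : ∀ X v → Disjoint X Q → colSum X ≋ v → sumOver f X ≈ ψ v
      ψ-realized X v X#Q X≋v = x+y≈z⇒y≈z-x (sumOver f Y) (sumOver f X) b
        (≈-trans (≈-reflexive (sym (sumOver-∪ f Y X Y#X))) (implied (Y ∪ X) Y∪X≋a))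
        where
        Y = proj₁ (U (λ i → a i + neg (v i)))
        Y⊆Q = proj₁ (proj₂ (U (λ i → a i + neg (v i))))
        Y#X : Disjoint Y X
        Y#X j∈Y j∈X = X#Q j∈X (Y⊆Q j∈Y)
        Y∪X≋a : colSum (Y ∪ X) ≋ a
        Y∪X≋a i = begin
          colSum (Y ∪ X) i                    ≡⟨ sumOver-∪ (λ j → col j i) Y X Y#X ⟩
          colSum Y i + colSum X i             ≈⟨ +-cong (proj₂ (proj₂ (U _)) i) (X≋v i) ⟩
          a i + neg (v i) + v i               ≡⟨ +-assoc (a i) _ (v i) ⟩
          a i + (neg (v i) + v i)             ≈⟨ +-congˡ (a i) (+-inverseˡ (v i)) ⟩
          a i + 0                             ≡⟨ +-identityʳ (a i) ⟩
          a i                                 ∎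
          where open ≈-Reasoning

      realize-outside : ∀ v → ∃ λ X → Disjoint X Q × colSum X ≋ v
      realize-outside v = let X , X⊆Q′ , X≋v = U′ v in X , (λ j∈X → Q′#Q (X⊆Q′ j∈X)) , X≋v

      ψ-cong : ∀ {v v′} → v ≋ v′ → ψ v ≈ ψ v′
      ψ-cong {v} {v′} v≋v′ = let X , X#Q , X≋v = realize-outside v in
        ≈-trans (≈-sym (ψ-realized X v X#Q X≋v)) (ψ-realized X v′ X#Q (λ i → ≈-trans (X≋v i) (v≋v′ i)))

      ψ-0 : ψ (λ _ → 0) ≈ 0
      ψ-0 = ≈-sym (≈-trans (≈-reflexive (sym (sumOver-⊥ f)))
                           (ψ-realized ⊥ _ (λ j∈⊥ → contradiction j∈⊥ ∉⊥)
                                           (λ i → ≈-reflexive (sumOver-⊥ (λ j → col j i)))))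

      ⁅w⁆#Q : ∀ {w} → w ∉ Q → Disjoint ⁅ w ⁆ Q
      ⁅w⁆#Q {w} w∉Q j∈⁅w⁆ = subst (_∉ Q) (sym (x∈⁅y⁆⇒x≡y w j∈⁅w⁆)) w∉Q

      f≈ψ-col : ∀ w → w ∉ Q → f w ≈ ψ (col w)
      f≈ψ-col w w∉Q = ≈-trans (≈-reflexive (sym (sumOver-⁅⁆ f w)))
                              (ψ-realized ⁅ w ⁆ (col w) (⁅w⁆#Q w∉Q)
                                          (λ i → ≈-reflexive (sumOver-⁅⁆ (λ j → col j i) w)))

      ψ-col-+ : ∀ w → w ∉ Q → w ∉ Q′ → ∀ v → ψ (λ i → col w i + v i) ≈ ψ (col w) + ψ v
      ψ-col-+ w w∉Q w∉Q′ v = begin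
        ψ (λ i → col w i + v i)        ≈⟨ ψ-realized (⁅ w ⁆ ∪ X) _ ⁅w⁆∪X#Q ⁅w⁆∪X≋ ⟨
        sumOver f (⁅ w ⁆ ∪ X)          ≡⟨ sumOver-∪ f ⁅ w ⁆ X w#X ⟩
        sumOver f ⁅ w ⁆ + sumOver f X  ≈⟨ +-cong (≈-trans (≈-reflexive (sumOver-⁅⁆ f w)) (f≈ψ-col w w∉Q))
                                                 (ψ-realized X v X#Q X≋v) ⟩
        ψ (col w) + ψ v                ∎
        where
        open ≈-Reasoning
        X = proj₁ (U′ v)
        X⊆Q′ = proj₁ (proj₂ (U′ v))
        X≋v = proj₂ (proj₂ (U′ v))
        X#Q : Disjoint X Q
        X#Q j∈X = Q′#Q (X⊆Q′ j∈X)
        w#X : Disjoint ⁅ w ⁆ X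
        w#X j∈⁅w⁆ j∈X = w∉Q′ (subst (_∈ Q′) (x∈⁅y⁆⇒x≡y w j∈⁅w⁆) (X⊆Q′ j∈X))
        ⁅w⁆∪X#Q : Disjoint (⁅ w ⁆ ∪ X) Q
        ⁅w⁆∪X#Q j∈ with x∈p∪q⁻ ⁅ w ⁆ X j∈
        ... | inj₁ j∈⁅w⁆ = ⁅w⁆#Q w∉Q j∈⁅w⁆
        ... | inj₂ j∈X   = X#Q j∈X
        ⁅w⁆∪X≋ : colSum (⁅ w ⁆ ∪ X) ≋ (λ i → col w i + v i)
        ⁅w⁆∪X≋ i = ≈-trans (≈-reflexive (trans (sumOver-∪ (λ j → col j i) ⁅ w ⁆ X w#X)
                                               (cong (_+ colSum X i) (sumOver-⁅⁆ (λ j → col j i) w))))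
                           (+-congˡ (col w i) (X≋v i))

      ψ-multiple-+ : ∀ w → w ∉ Q → w ∉ Q′ → ∀ c v → ψ (λ i → c * col w i + v i) ≈ c * ψ (col w) + ψ v
      ψ-multiple-+ w w∉Q w∉Q′ zero    v = ≈-refl
      ψ-multiple-+ w w∉Q w∉Q′ (suc c) v = begin
        ψ (λ i → (col w i + c * col w i) + v i)   ≈⟨ ψ-cong (λ i → ≈-reflexive (+-assoc (col w i) _ (v i))) ⟩
        ψ (λ i → col w i + (c * col w i + v i))   ≈⟨ ψ-col-+ w w∉Q w∉Q′ _ ⟩
        ψ (col w) + ψ (λ i → c * col w i + v i)   ≈⟨ +-congˡ (ψ (col w)) (ψ-multiple-+ w w∉Q w∉Q′ c v) ⟩
        ψ (col w) + (c * ψ (col w) + ψ v)         ≡⟨ +-assoc (ψ (col w)) _ _ ⟨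
        ψ (col w) + c * ψ (col w) + ψ v           ∎
        where open ≈-Reasoning

      ψ-lin-+ : ∀ {k′} (B′ : Fin k′ → Fin n) → (∀ ℓ → B′ ℓ ∉ Q) → (∀ ℓ → B′ ℓ ∉ Q′) → ∀ t v →
                ψ (λ i → lin (col ∘ B′) t i + v i) ≈ sumFin k′ (λ ℓ → t ℓ * f (B′ ℓ)) + ψ v
      ψ-lin-+ {zero}   B′ _   _    t v = ≈-refl
      ψ-lin-+ {suc k′} B′ ∉Q ∉Q′ t v = begin
        ψ (λ i → t₀ * col w i + lin (col ∘ B₊) t₊ i + v i)
          ≈⟨ ψ-cong (λ i → ≈-reflexive (+-assoc (t₀ * col w i) _ (v i))) ⟩
        ψ (λ i → t₀ * col w i + (lin (col ∘ B₊) t₊ i + v i))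
          ≈⟨ ψ-multiple-+ w (∉Q F.zero) (∉Q′ F.zero) t₀ _ ⟩
        t₀ * ψ (col w) + ψ (λ i → lin (col ∘ B₊) t₊ i + v i)
          ≈⟨ +-cong (*-congˡ t₀ (≈-sym (f≈ψ-col w (∉Q F.zero)))) (ψ-lin-+ B₊ (∉Q ∘ F.suc) (∉Q′ ∘ F.suc) t₊ v) ⟩
        t₀ * f w + (sumFin k′ (λ ℓ → t₊ ℓ * f (B₊ ℓ)) + ψ v)  ≡⟨ +-assoc (t₀ * f w) _ _ ⟨
        t₀ * f w + sumFin k′ (λ ℓ → t₊ ℓ * f (B₊ ℓ)) + ψ v    ∎
        where
        open ≈-Reasoning
        w = B′ F.zero
        B₊ = B′ ∘ F.suc
        t₀ = t F.zero
        t₊ = t ∘ F.suc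

      ψ-representation : ∀ {u} t → lin (col ∘ B) t ≋ u → ψ u ≈ sumFin k (λ ℓ → t ℓ * f (B ℓ))
      ψ-representation {u} t t≋u = begin
        ψ u
          ≈⟨ ψ-cong (λ i → ≈-trans (≈-sym (t≋u i)) (≈-reflexive (sym (+-identityʳ _)))) ⟩
        ψ (λ i → lin (col ∘ B) t i + 0)                  ≈⟨ ψ-lin-+ B B∉Q B∉Q′ t (λ _ → 0) ⟩
        sumFin k (λ ℓ → t ℓ * f (B ℓ)) + ψ (λ _ → 0)     ≈⟨ +-congˡ _ ψ-0 ⟩
        sumFin k (λ ℓ → t ℓ * f (B ℓ)) + 0               ≡⟨ +-identityʳ _ ⟩
        sumFin k (λ ℓ → t ℓ * f (B ℓ))                   ∎
        where open ≈-Reasoning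

      ψ-linear : ∀ u → ψ u ≈ sumFin m (λ i → u i * multiplier i)
      ψ-linear u = ≈-trans (ψ-representation t t≋u) (≈-reflexive (sumFin-compose k m u τ (f ∘ B)))
        where
        τ : Fin m → V k
        τ i = proj₁ (coords (unit i))
        t : V k
        t ℓ = sumFin m (λ i → u i * τ i ℓ)
        t≋u : lin (col ∘ B) t ≋ u
        t≋u r = begin
          sumFin k (λ ℓ → t ℓ * col (B ℓ) r)
            ≡⟨ sumFin-compose k m u τ (λ ℓ → col (B ℓ) r) ⟩
          sumFin m (λ i → u i * sumFin k (λ ℓ → τ i ℓ * col (B ℓ) r))
            ≈⟨ sumFin-cong-≈ m (λ i → *-congˡ (u i) (proj₂ (coords (unit i)) r)) ⟩
          sumFin m (λ i → u i * δ i r)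
            ≡⟨ sumFin-cong m (λ i → *-comm (u i) (δ i r)) ⟩
          sumFin m (λ i → δ i r * u i)                                   ≡⟨ sumFin-δ m u r ⟩
          u r                                                            ∎
          where open ≈-Reasoning

      coefficient : ∀ j → j ∉ Q → f j ≈ sumFin m (λ i → multiplier i * col j i)
      coefficient j j∉Q = ≈-trans (f≈ψ-col j j∉Q) (≈-trans (ψ-linear (col j))
                            (≈-reflexive (sumFin-cong m (λ i → *-comm (col j i) (multiplier i)))))

      constant : b ≈ sumFin m (λ i → multiplier i * a i)
      constant = let X , X#Q , X≋a = realize-outside a in
        ≈-trans (≈-sym (implied X X≋a)) (≈-trans (ψ-realized X a X#Q X≋a) (≈-trans (ψ-linear a)
          (≈-reflexive (sumFin-cong m (λ i → *-comm (a i) (multiplier i))))))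

  implied-in-span : (∀ X → colSum X ≋ a → sumOver f X ≈ b) →
                    ∀ {Q Q′} → Universal Q → Universal Q′ → Disjoint Q Q′ →
                    ∀ {k} (B : Fin k → Fin n) → (∀ u → Span (col ∘ B) u) → (∀ ℓ → B ℓ ∉ Q) → (∀ ℓ → B ℓ ∉ Q′) →
                    Σ (Fin m → Fin p) λ lam → (∀ j → f j ≈ sumFin m (λ i → toℕ (lam i) * col j i))
                                            × b ≈ sumFin m (λ i → toℕ (lam i) * a i)
  implied-in-span implied {Q} U U′ Q#Q′ B coords B∉Q B∉Q′ =
    reduce ∘ multiplier B coords , coefficient , ≈-trans Q-side.constant (reduced a)
    where
    module Q-side  = Completion B coords implied U U′ (λ j∈Q′ j∈Q → Q#Q′ j∈Q j∈Q′) B∉Q B∉Q′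
    module Q′-side = Completion B coords implied U′ U Q#Q′ B∉Q′ B∉Q
    reduced : ∀ v → sumFin m (λ i → multiplier B coords i * v i) ≈
                    sumFin m (λ i → toℕ (reduce (multiplier B coords i)) * v i)
    reduced v = sumFin-cong-≈ m (λ i → *-congʳ (v i) (≈-sym (reduce-≈ _)))
    coefficient : ∀ j → f j ≈ sumFin m (λ i → toℕ (reduce (multiplier B coords i)) * col j i)
    coefficient j with j ∈? Q
    ... | no  j∉Q = ≈-trans (Q-side.coefficient j j∉Q) (reduced (col j))
    ... | yes j∈Q = ≈-trans (Q′-side.coefficient j (Q#Q′ j∈Q)) (reduced (col j))

binary-logarithm : ∀ n → 1 ≤ n → ∃ λ T → 2 ^ T ≤ n × n < 2 ^ suc T
binary-logarithm (suc zero)        _ = 0 , ≤-refl , s≤s (s≤s z≤n)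
binary-logarithm (suc n@(suc _)) _ with binary-logarithm n (s≤s z≤n)
... | T , 2^T≤n , n<2^[1+T] with suc n <? 2 ^ suc T
...   | yes 1+n<2^[1+T] = T , m≤n⇒m≤1+n 2^T≤n , 1+n<2^[1+T]
...   | no  1+n≮2^[1+T] = suc T , ≤-reflexive (sym 1+n≡2^[1+T]) ,
                          subst (_< 2 ^ suc (suc T)) (sym 1+n≡2^[1+T]) (^-monoʳ-< 2 (s≤s (s≤s z≤n)) (n<1+n (suc T)))
  where
  1+n≡2^[1+T] : suc n ≡ 2 ^ suc T
  1+n≡2^[1+T] = ≤-antisym n<2^[1+T] (≮⇒≥ 1+n≮2^[1+T])

[m*n]^k≡m^k*n^k : ∀ m n k → (m * n) ^ k ≡ m ^ k * n ^ k
[m*n]^k≡m^k*n^k m n zero    = refl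
[m*n]^k≡m^k*n^k m n (suc k) = trans (cong (m * n *_) ([m*n]^k≡m^k*n^k m n k)) (exchange m n (m ^ k) (n ^ k))
  where
  exchange : ∀ a b c d → a * b * (c * d) ≡ a * c * (b * d)
  exchange = solve-∀

-- Bernoulli-type estimate: each factor (1 + p) / p is traded against the ratio (d + 2) / (d + 1).
[1+p]^k*[1+d]≤p^k*[1+p] : ∀ p k d → k + d ≡ p → suc p ^ k * suc d ≤ p ^ k * suc p
[1+p]^k*[1+d]≤p^k*[1+p] p zero    d refl = ≤-refl
[1+p]^k*[1+d]≤p^k*[1+p] p (suc k) d k+d≡p = begin
  suc p * suc p ^ k * suc d        ≡⟨ rearrange (suc p) (suc p ^ k) (suc d) ⟩
  suc p * suc d * suc p ^ k        ≤⟨ *-monoˡ-≤ (suc p ^ k) step ⟩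
  p * suc (suc d) * suc p ^ k      ≡⟨ rearrange′ p (suc (suc d)) (suc p ^ k) ⟩
  p * (suc p ^ k * suc (suc d))    ≤⟨ *-monoʳ-≤ p ([1+p]^k*[1+d]≤p^k*[1+p] p k (suc d) (trans (+-suc k d) k+d≡p)) ⟩
  p * (p ^ k * suc p)              ≡⟨ *-assoc p (p ^ k) (suc p) ⟨
  p * p ^ k * suc p                ∎
  where
  open ≤-Reasoning
  rearrange : ∀ a b c → a * b * c ≡ a * c * b
  rearrange = solve-∀
  rearrange′ : ∀ a b c → a * b * c ≡ a * (c * b)
  rearrange′ = solve-∀
  step : suc p * suc d ≤ p * suc (suc d)
  step = begin
    suc p * suc d          ≡⟨ solve-∀-1 p d ⟩
    p * suc d + suc d      ≤⟨ +-monoʳ-≤ (p * suc d) (subst (suc d ≤_) k+d≡p (s≤s (m≤n+m d k))) ⟩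
    p * suc d + p          ≡⟨ solve-∀-2 p d ⟩
    p * suc (suc d)        ∎
    where
    solve-∀-1 : ∀ p d → suc p * suc d ≡ p * suc d + suc d
    solve-∀-1 = solve-∀
    solve-∀-2 : ∀ p d → p * suc d + p ≡ p * suc (suc d)
    solve-∀-2 = solve-∀

⌈n/2⌉≤1+⌊n/2⌋ : ∀ n → ⌈ n /2⌉ ≤ suc ⌊ n /2⌋
⌈n/2⌉≤1+⌊n/2⌋ zero          = z≤n
⌈n/2⌉≤1+⌊n/2⌋ (suc zero)    = ≤-refl
⌈n/2⌉≤1+⌊n/2⌋ (suc (suc n)) = s≤s (⌈n/2⌉≤1+⌊n/2⌋ n)

[1+p]^⌈p/2⌉≤2*p^⌈p/2⌉ : ∀ p → suc p ^ ⌈ p /2⌉ ≤ 2 * p ^ ⌈ p /2⌉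
[1+p]^⌈p/2⌉≤2*p^⌈p/2⌉ p = *-cancelʳ-≤ _ _ (suc d) (begin
  suc p ^ h * suc d      ≤⟨ [1+p]^k*[1+d]≤p^k*[1+p] p h d (trans (+-comm h d) (⌊n/2⌋+⌈n/2⌉≡n p)) ⟩
  p ^ h * suc p          ≤⟨ *-monoʳ-≤ (p ^ h) 1+p≤2*[1+d] ⟩
  p ^ h * (2 * suc d)    ≡⟨ rearrange (p ^ h) 2 (suc d) ⟩
  2 * p ^ h * suc d      ∎)
  where
  open ≤-Reasoning
  h = ⌈ p /2⌉
  d = ⌊ p /2⌋
  1+p≤2*[1+d] : suc p ≤ 2 * suc d
  1+p≤2*[1+d] = begin
    suc p            ≡⟨ cong suc (⌊n/2⌋+⌈n/2⌉≡n p) ⟨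
    suc (d + h)      ≤⟨ s≤s (+-monoʳ-≤ d (⌈n/2⌉≤1+⌊n/2⌋ p)) ⟩
    suc (d + suc d)  ≡⟨ double d ⟩
    2 * suc d        ∎
    where
    double : ∀ d → suc (d + suc d) ≡ 2 * suc d
    double = solve-∀
  rearrange : ∀ a b c → a * (b * c) ≡ b * a * c
  rearrange = solve-∀

p≤2*⌈p/2⌉ : ∀ p → p ≤ 2 * ⌈ p /2⌉
p≤2*⌈p/2⌉ p = begin
  p                      ≡⟨ ⌊n/2⌋+⌈n/2⌉≡n p ⟨
  ⌊ p /2⌋ + ⌈ p /2⌉      ≤⟨ +-monoˡ-≤ ⌈ p /2⌉ (⌊n/2⌋≤⌈n/2⌉ p) ⟩
  ⌈ p /2⌉ + ⌈ p /2⌉      ≡⟨ cong (⌈ p /2⌉ +_) (+-identityʳ ⌈ p /2⌉) ⟨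
  2 * ⌈ p /2⌉            ∎
  where open ≤-Reasoning

2^[2[mqT+m]]≤p^[2m²q+2m] : ∀ {p m q T} → 2 ≤ p → 2 ^ T ≤ p ^ m →
                           2 ^ (2 * (m * q * T + m)) ≤ p ^ (m * (2 * m * q) + 2 * m)
2^[2[mqT+m]]≤p^[2m²q+2m] {p} {m} {q} {T} 2≤p 2^T≤p^m = begin
  2 ^ (2 * (m * q * T + m))             ≡⟨ cong (2 ^_) (regroup m q T) ⟩
  2 ^ (T * (2 * m * q) + 2 * m)         ≡⟨ ^-distribˡ-+-* 2 (T * (2 * m * q)) (2 * m) ⟩
  2 ^ (T * (2 * m * q)) * 2 ^ (2 * m)   ≡⟨ cong (_* 2 ^ (2 * m)) (^-*-assoc 2 T (2 * m * q)) ⟨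
  (2 ^ T) ^ (2 * m * q) * 2 ^ (2 * m)   ≤⟨ *-mono-≤ (^-monoˡ-≤ (2 * m * q) 2^T≤p^m) (^-monoˡ-≤ (2 * m) 2≤p) ⟩
  (p ^ m) ^ (2 * m * q) * p ^ (2 * m)   ≡⟨ cong (_* p ^ (2 * m)) (^-*-assoc p m (2 * m * q)) ⟩
  p ^ (m * (2 * m * q)) * p ^ (2 * m)   ≡⟨ ^-distribˡ-+-* p (m * (2 * m * q)) (2 * m) ⟨
  p ^ (m * (2 * m * q) + 2 * m)         ∎
  where
  open ≤-Reasoning
  regroup : ∀ a b c → 2 * (a * b * c + a) ≡ c * (2 * a * b) + 2 * a
  regroup = solve-∀

2m²q+2m<3m³[q+2] : ∀ {m} q → 1 ≤ m → m * (2 * m * q) + 2 * m < 3 * m ^ 3 * (q + 2)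
2m²q+2m<3m³[q+2] {suc m′} q _ = subst (suc m′ * (2 * suc m′ * q) + 2 * suc m′ <_) (sym (expand m′ q)) (m<m+n _ z<s)
  where
  expand : ∀ a b → 3 * (suc a * (suc a * (suc a * 1))) * (b + 2) ≡
           suc a * (2 * suc a * b) + 2 * suc a +
           suc (suc a * suc a * b * (3 * a + 1) + 6 * (a * a * a) + 18 * (a * a) + 16 * a + 3)
  expand = solve-∀

-- With h = ⌈p/2⌉ one has (1 + p)^h ≤ 2 p^h, so the h-th power of the hypothesis compares
-- 2^w p^(hw) with p^(6m³h) p^(hw); for w ≤ 2(m(p − 2)T + m) the first is too small.
weight-bound : ∀ {p m T w} → 5 ≤ p → 1 ≤ m → 2 ^ T ≤ p ^ m → p ^ (w + 6 * m ^ 3) ≤ suc p ^ w →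
               2 * (m * (p ∸ 2) * T + m) < w
weight-bound {p} {m} {T} {w} p≥5 m≥1 2^T≤p^m hw =
  ≰⇒> λ w≤W → <-irrefl refl (<-≤-trans (chain w≤W) (^-monoˡ-≤ h hw))
  where
  q = p ∸ 2
  h = ⌈ p /2⌉
  2≤p : 2 ≤ p
  2≤p = ≤-trans (s≤s (s≤s z≤n)) p≥5
  instance
    p-nonZero : NonZero p
    p-nonZero = >-nonZero (≤-trans z<s p≥5)
  exponent-gap : m * (2 * m * q) + 2 * m < 6 * m ^ 3 * h
  exponent-gap = begin-strict
    m * (2 * m * q) + 2 * m  <⟨ 2m²q+2m<3m³[q+2] q m≥1 ⟩
    3 * m ^ 3 * (q + 2)      ≡⟨ cong (3 * m ^ 3 *_) (m∸n+n≡m 2≤p) ⟩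
    3 * m ^ 3 * p            ≤⟨ *-monoʳ-≤ (3 * m ^ 3) (p≤2*⌈p/2⌉ p) ⟩
    3 * m ^ 3 * (2 * h)      ≡⟨ regroup (m ^ 3) h ⟩
    6 * m ^ 3 * h            ∎
    where
    open ≤-Reasoning
    regroup : ∀ a b → 3 * a * (2 * b) ≡ 6 * a * b
    regroup = solve-∀
  chain : w ≤ 2 * (m * q * T + m) → (suc p ^ w) ^ h < (p ^ (w + 6 * m ^ 3)) ^ h
  chain w≤W = begin-strict
    (suc p ^ w) ^ h                   ≡⟨ trans (^-*-assoc (suc p) w h) (cong (suc p ^_) (*-comm w h)) ⟩
    suc p ^ (h * w)                   ≡⟨ ^-*-assoc (suc p) h w ⟨
    (suc p ^ h) ^ w                   ≤⟨ ^-monoˡ-≤ w ([1+p]^⌈p/2⌉≤2*p^⌈p/2⌉ p) ⟩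
    (2 * p ^ h) ^ w                   ≡⟨ [m*n]^k≡m^k*n^k 2 (p ^ h) w ⟩
    2 ^ w * (p ^ h) ^ w               ≤⟨ *-monoˡ-≤ ((p ^ h) ^ w) (≤-trans (^-monoʳ-≤ 2 w≤W)
                                           (2^[2[mqT+m]]≤p^[2m²q+2m] {p} {m} {q} {T} 2≤p 2^T≤p^m)) ⟩
    p ^ (m * (2 * m * q) + 2 * m) * (p ^ h) ^ w
                                      <⟨ *-monoˡ-< ((p ^ h) ^ w) {{m^n≢0 (p ^ h) w {{m^n≢0 p h}}}}
                                                   (^-monoʳ-< p (≤-trans (s≤s (s≤s z≤n)) p≥5) exponent-gap) ⟩
    p ^ (6 * m ^ 3 * h) * (p ^ h) ^ w ≡⟨ cong (p ^ (6 * m ^ 3 * h) *_) (^-*-assoc p h w) ⟩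
    p ^ (6 * m ^ 3 * h) * p ^ (h * w) ≡⟨ ^-distribˡ-+-* p (6 * m ^ 3 * h) (h * w) ⟨
    p ^ (6 * m ^ 3 * h + h * w)       ≡⟨ cong (p ^_) (regroup (m ^ 3) h w) ⟩
    p ^ ((w + 6 * m ^ 3) * h)         ≡⟨ ^-*-assoc p (w + 6 * m ^ 3) h ⟨
    (p ^ (w + 6 * m ^ 3)) ^ h         ∎
    where
    open ≤-Reasoning
    regroup : ∀ x b c → 6 * x * b + b * c ≡ (c + 6 * x) * b
    regroup = solve-∀

corollary5p3 : (p : ℕ) .{{_ : NonZero p}} → Prime p → 5 ≤ p →
    (m n : ℕ) (M : Mat p m n) (a : Fin m → Fin p) →
    DistanceCondition p M →
    (f : Fin n → Fin p) (b : Fin p) →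
    (∀ (x : Fin n → Bool) → SatSystem p M a x → SatEq p f b x) →
    InSpan p M a f b
corollary5p3 p p-prime p≥5 m n M a dist f b implied =
  let Q , Q′ , universal , universal′ , Q#Q′ , separating = universal-pair T T-bound robust
      β , spans = spanning-basis col (⊤ ─ Q ─ Q′) separating
      open Basis β
  in implied-in-span (implied ∘ lookup) universal universal′ Q#Q′ index spans
                     (x∈p─q⇒x∉q ⊤ Q ∘ p─q⊆p (⊤ ─ Q) Q′ ∘ index∈P) (x∈p─q⇒x∉q (⊤ ─ Q) Q′ ∘ index∈P)
  where
  col : Fin n → Fin m → ℕ
  col j i = toℕ (M i j)
  open LinearAlgebra p p-prime m
  open UniversalSets p p-prime col
  open ImpliedEquation p p-prime col (toℕ ∘ a) (toℕ ∘ f) (toℕ b)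
  log = binary-logarithm (p ^ m) (m^n>0 p m)
  T = proj₁ log
  T-bound : ∀ {t} → 2 ^ t ≤ p ^ m → t ≤ T
  T-bound 2^t≤p^m = ≮⇒≥ λ T<t → <⇒≱ (proj₂ (proj₂ log)) (≤-trans (^-monoʳ-≤ 2 T<t) 2^t≤p^m)
  robust : RobustlySeparating (2 * (m * (p ∸ 2) * T + m)) ⊤
  robust = heavy⇒robustly-separating _ λ y y≢0 →
    weight-bound p≥5 (≤-trans (s≤s z≤n) (FinP.toℕ<n (proj₁ y≢0))) (proj₁ (proj₂ log)) (dist y y≢0)
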